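{- Let $\alpha$ be a fixed positive integer. There exists a positive integer $j(\alpha)$ such that for every integer $n$ with $n > j(\alpha)$ and $n > 2\alpha$, every graph $G \in K_n - \alpha e$ satisfies $\mu_s(G) = +\infty$.
   Context: All graphs are finite and simple. For integers $a\le b$, $[a,b]$ denotes the set of integers $x$ with $a\le x\le b$. A graph $G$ is super edge-magic if there is a bijection $f:V(G)\cup E(G)\to[1,|V(G)|+|E(G)|]$ with $f(V(G))=[1,|V(G)|]$ such that $f(u)+f(v)+f(uv)$ is the same constant for every edge $uv\in E(G)$. The super edge-magic deficiency $\mu_s(G)$ of a graph $G$ is the smallest nonnegative integer $k$ such that the disjoint union $G\cup kK_1$ of $G$ with $k$ isolated vertices is super edge-magic, or $+\infty$ if no such $k$ exists. For a positive integer $\alpha$, $K_n-\alpha e$ denotes the set of all graphs obtained from the complete graph $K_n$ by removing exactly $\alpha$ edges (keeping all $n$ vertices). -}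

module Defs where

open import Data.Nat using (ℕ; _+_; _≤_; _<ᵇ_)
open import Data.Bool using (Bool; true; false; _∧_; if_then_else_)
open import Data.Fin using (Fin; toℕ; splitAt) renaming (_<_ to _<ᶠ_)
open import Data.List using (List; map; allFin)
open import Data.Nat.ListAction using (sum)
open import Data.Sum using (_⊎_; inj₁; inj₂)
open import Data.Product using (Σ; ∃; _×_; _,_)
open import Relation.Binary.PropositionalEquality using (_≡_)
open import Function.Definitions using (Injective)

record Graph (n : ℕ) : Set where
  field
    adj    : Fin n → Fin n → Bool
    sym    : ∀ i j → adj i j ≡ adj j i
    irrefl : ∀ i → adj i i ≡ false
open Graph public

-- Edges: unordered pairs {i,j}, represented once as i < j.
Edge : ∀ {n} → Graph n → Set
Edge {n} G = Σ (Fin n) λ i → Σ (Fin n) λ j → (i <ᶠ j) × (adj G i j ≡ true)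

pairCount : ∀ {n} → (Fin n → Fin n → Bool) → ℕ
pairCount {n} a =
  sum (map (λ i → sum (map (λ j → if (toℕ i <ᵇ toℕ j) ∧ a i j then 1 else 0)
                           (allFin n)))
           (allFin n))

edgeCount : ∀ {n} → Graph n → ℕ
edgeCount G = pairCount (adj G)

nonEdgeCount : ∀ {n} → Graph n → ℕ
nonEdgeCount G = pairCount (λ i j → if adj G i j then false else true)

InKnMinus : ∀ {n} → ℕ → Graph n → Set
InKnMinus α G = nonEdgeCount G ≡ α

-- G ∪ kK₁ : disjoint union with k isolated vertices (vertices n, …, n+k-1)
addIsolated : ∀ {n} → Graph n → (k : ℕ) → Graph (n + k)
addIsolated {n} G k = record { adj = a ; sym = s ; irrefl = r }
  where
  a : Fin (n + k) → Fin (n + k) → Bool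
  a x y with splitAt n x | splitAt n y
  ... | inj₁ i | inj₁ j = adj G i j
  ... | _      | _      = false
  s : ∀ x y → a x y ≡ a y x
  s x y with splitAt n x | splitAt n y
  ... | inj₁ i | inj₁ j = sym G i j
  ... | inj₁ i | inj₂ j = Relation.Binary.PropositionalEquality.refl
  ... | inj₂ i | inj₁ j = Relation.Binary.PropositionalEquality.refl
  ... | inj₂ i | inj₂ j = Relation.Binary.PropositionalEquality.refl
  r : ∀ x → a x x ≡ false
  r x with splitAt n x
  ... | inj₁ i = irrefl G i
  ... | inj₂ i = Relation.Binary.PropositionalEquality.refl

record SuperEdgeMagicLabeling {m : ℕ} (G : Graph m) : Set where
  field
    f        : Fin m ⊎ Edge G → ℕ
    inj      : Injective _≡_ _≡_ f
    range    : ∀ x → 1 ≤ f x × f x ≤ m + edgeCount G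
    onto     : ∀ y → 1 ≤ y → y ≤ m + edgeCount G → ∃ λ x → f x ≡ y
    vRange   : ∀ v → f (inj₁ v) ≤ m
    vOnto    : ∀ y → 1 ≤ y → y ≤ m → ∃ λ v → f (inj₁ v) ≡ y
    c        : ℕ
    magic    : ∀ (e : Edge G) → let (i , j , _ , _) = e in
                 f (inj₁ i) + f (inj₁ j) + f (inj₂ e) ≡ c

SuperEdgeMagic : ∀ {m} → Graph m → Set
SuperEdgeMagic G = SuperEdgeMagicLabeling G

-- μ_s(G) = +∞ : G ∪ kK₁ is super edge-magic for no k
DeficiencyInfinite : ∀ {n} → Graph n → Set
DeficiencyInfinite G = ∀ (k : ℕ) → SuperEdgeMagic (addIsolated G k) → Data.Empty.⊥
  where import Data.Empty

module Submission where

-- The vertices of G adjacent to all others form a clique of size t ≥ n − 2α. In a super edge-magic labelling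
-- of G ∪ kK₁ the edge labels are the E consecutive integers above the vertex labels, and all but m ≤ 4αt of
-- them label edges of that clique. The affine change w = t·ℓ − (t·c − 2σ) turns the magic condition on a
-- clique edge uv into w = −(a u + a v) for vertex values a summing to 0, and sums s = a u + a v over all
-- N = t(t − 1)/2 pairs satisfy 4 (∑ s²)² ≤ t² ∑ s⁴, so ∑ s⁴ / (∑ s²)² ≳ 2/N. A full interval of about N
-- values has this ratio near 9/(5N) (the kurtosis of the uniform distribution), and once t ≥ 20000 α the
-- m other labels are too few to close the gap.

module Integers where

  open import Data.Nat as ℕ using (ℕ)
  import Data.Nat.Properties as ℕ
  open import Relation.Nullary using (yes; no)
  open import Data.Integer as ℤ using (ℤ; +_; _+_; _*_; _-_; -_; ∣_∣; _≤_)
  import Data.Integer.Properties as ℤ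
  open import Data.Integer.Tactic.RingSolver using (solve-∀)
  open import Data.Sum using (inj₁; inj₂)
  open import Relation.Binary.PropositionalEquality

  square-∣∣ : ∀ i → i * i ≡ + ∣ i ∣ * + ∣ i ∣
  square-∣∣ i with ℤ.+∣i∣≡i⊎+∣i∣≡-i i
  ... | inj₁ eq = cong₂ _*_ (sym eq) (sym eq)
  ... | inj₂ eq = trans (sym (neg-square i)) (cong₂ _*_ (sym eq) (sym eq))
    where neg-square : ∀ x → (- x) * (- x) ≡ x * x
          neg-square = solve-∀

  square-nonneg : ∀ i → + 0 ≤ i * i
  square-nonneg i = subst (+ 0 ≤_) (trans (ℤ.pos-* ∣ i ∣ ∣ i ∣) (sym (square-∣∣ i))) (ℤ.+≤+ ℕ.z≤n)

  *-nonneg : ∀ {i j} → + 0 ≤ i → + 0 ≤ j → + 0 ≤ i * j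
  *-nonneg {+ m} {+ n} _ _ = subst (+ 0 ≤_) (ℤ.pos-* m n) (ℤ.+≤+ ℕ.z≤n)

  ≤-+-nonneg : ∀ i {j} → + 0 ≤ j → i ≤ i + j
  ≤-+-nonneg i {j} 0≤j = subst (_≤ i + j) (ℤ.+-identityʳ i) (ℤ.+-monoʳ-≤ i 0≤j)

  +-nonneg : ∀ {i j} → + 0 ≤ i → + 0 ≤ j → + 0 ≤ i + j
  +-nonneg {i} 0≤i 0≤j = ℤ.≤-trans 0≤i (≤-+-nonneg i 0≤j)

  -- Syntax for moving polynomial identities proved in ℤ back to ℕ.
  infixl 6 _‵+_
  infixl 7 _‵*_

  data Poly : Set where
    ‵_         : ℕ → Poly
    _‵+_ _‵*_  : Poly → Poly → Poly

  ⟦_⟧ℕ : Poly → ℕ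
  ⟦ ‵ n ⟧ℕ    = n
  ⟦ p ‵+ q ⟧ℕ = ⟦ p ⟧ℕ ℕ.+ ⟦ q ⟧ℕ
  ⟦ p ‵* q ⟧ℕ = ⟦ p ⟧ℕ ℕ.* ⟦ q ⟧ℕ

  ⟦_⟧ℤ : Poly → ℤ
  ⟦ ‵ n ⟧ℤ    = + n
  ⟦ p ‵+ q ⟧ℤ = ⟦ p ⟧ℤ + ⟦ q ⟧ℤ
  ⟦ p ‵* q ⟧ℤ = ⟦ p ⟧ℤ * ⟦ q ⟧ℤ

  +⟦⟧ℕ≡⟦⟧ℤ : ∀ p → + ⟦ p ⟧ℕ ≡ ⟦ p ⟧ℤ
  +⟦⟧ℕ≡⟦⟧ℤ (‵ n)    = refl
  +⟦⟧ℕ≡⟦⟧ℤ (p ‵+ q) = trans (ℤ.pos-+ ⟦ p ⟧ℕ ⟦ q ⟧ℕ) (cong₂ _+_ (+⟦⟧ℕ≡⟦⟧ℤ p) (+⟦⟧ℕ≡⟦⟧ℤ q))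
  +⟦⟧ℕ≡⟦⟧ℤ (p ‵* q) = trans (ℤ.pos-* ⟦ p ⟧ℕ ⟦ q ⟧ℕ) (cong₂ _*_ (+⟦⟧ℕ≡⟦⟧ℤ p) (+⟦⟧ℕ≡⟦⟧ℤ q))

  ⟦⟧ℤ-≡⇒⟦⟧ℕ-≡ : ∀ p q → ⟦ p ⟧ℤ ≡ ⟦ q ⟧ℤ → ⟦ p ⟧ℕ ≡ ⟦ q ⟧ℕ
  ⟦⟧ℤ-≡⇒⟦⟧ℕ-≡ p q eq = ℤ.+-injective (trans (+⟦⟧ℕ≡⟦⟧ℤ p) (trans eq (sym (+⟦⟧ℕ≡⟦⟧ℤ q))))

  ⟦⟧ℤ-≤⇒⟦⟧ℕ-≤ : ∀ p q → ⟦ p ⟧ℤ ≤ ⟦ q ⟧ℤ → ⟦ p ⟧ℕ ℕ.≤ ⟦ q ⟧ℕ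
  ⟦⟧ℤ-≤⇒⟦⟧ℕ-≤ p q le = ℤ.drop‿+≤+ (subst₂ _≤_ (sym (+⟦⟧ℕ≡⟦⟧ℤ p)) (sym (+⟦⟧ℕ≡⟦⟧ℤ q)) le)

  ∣2i-n∣≤n : ∀ {i n} → i ℕ.≤ n → ∣ + (2 ℕ.* i) - + n ∣ ℕ.≤ n
  ∣2i-n∣≤n {i} {n} i≤n with n ℕ.≤? 2 ℕ.* i
  ... | yes n≤2i rewrite ℤ.m-n≡m⊖n (2 ℕ.* i) n | ℤ.⊖-≥ n≤2i =
    ℕ.≤-trans (ℕ.∸-monoˡ-≤ n (ℕ.*-monoʳ-≤ 2 i≤n))
      (ℕ.≤-reflexive (trans (cong (ℕ._∸ n) (cong (n ℕ.+_) (ℕ.+-identityʳ n))) (ℕ.m+n∸n≡m n n)))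
  ... | no n≰2i rewrite ℤ.m-n≡m⊖n (2 ℕ.* i) n | ℤ.⊖-< (ℕ.≰⇒> n≰2i) | ℤ.∣-i∣≡∣i∣ (+ (n ℕ.∸ 2 ℕ.* i)) = ℕ.m∸n≤m n (2 ℕ.* i)

module Lists where

  open import Data.Nat using (ℕ; suc; _+_; _*_; _≤_; z≤n; s≤s)
  import Data.Nat.Tactic.RingSolver as ℕ-Ring
  open import Data.List using (List; []; _∷_; map; _++_; length)
  open import Data.List.Properties using (length-++; length-map; length-removeAt′)
  open import Data.List.Membership.Propositional using (_∈_)
  open import Data.List.Membership.Propositional.Properties using (∈-++⁺ˡ; ∈-++⁺ʳ; ∈-++⁻; ∈-map⁺; ∈-map⁻)
  open import Data.List.Relation.Unary.Any using (here; there; _─_)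
  open import Data.List.Relation.Unary.All as All using ()
  import Data.List.Relation.Unary.All.Properties as All
  open import Data.List.Relation.Unary.AllPairs using (AllPairs; []; _∷_)
  open import Data.List.Relation.Unary.Unique.Propositional using (Unique)
  import Data.List.Relation.Unary.Unique.Propositional.Properties as Unique
  open import Data.Product using (Σ-syntax; _×_; _,_; proj₁; proj₂)
  open import Data.Sum using (inj₁; inj₂)
  open import Data.Empty using (⊥; ⊥-elim)
  open import Relation.Binary.PropositionalEquality

  ∈-─⁺ : ∀ {A : Set} {x z : A} (ys : List A) (p : x ∈ ys) → z ∈ ys → z ≢ x → z ∈ (ys ─ p)
  ∈-─⁺ (y ∷ ys) (here refl) (here refl) z≢x = ⊥-elim (z≢x refl)
  ∈-─⁺ (y ∷ ys) (here refl) (there q)   z≢x = q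
  ∈-─⁺ (y ∷ ys) (there p)   (here refl) z≢x = here refl
  ∈-─⁺ (y ∷ ys) (there p)   (there q)   z≢x = there (∈-─⁺ ys p q z≢x)

  ∈-─⁻ : ∀ {A : Set} {x z : A} (ys : List A) (p : x ∈ ys) → z ∈ (ys ─ p) → z ∈ ys
  ∈-─⁻ (y ∷ ys) (here _)  q           = there q
  ∈-─⁻ (y ∷ ys) (there p) (here refl) = here refl
  ∈-─⁻ (y ∷ ys) (there p) (there q)   = there (∈-─⁻ ys p q)

  module _ {A : Set} where

    length-≤-injection : ∀ {B : Set} (R : A → B → Set) {xs : List A} (ys : List B) → Unique xs →
      (∀ {x} → x ∈ xs → Σ[ y ∈ B ] y ∈ ys × R x y) →
      (∀ {x x′ y} → R x y → R x′ y → x ≡ x′) → length xs ≤ length ys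
    length-≤-injection R {[]}     ys []         image injective = z≤n
    length-≤-injection R {x ∷ xs} ys (x∉ ∷ uxs) image injective with image (here refl)
    ... | y , y∈ys , Rxy =
      subst (suc (length xs) ≤_) (sym (length-removeAt′ ys _))
        (s≤s (length-≤-injection R (ys ─ y∈ys) uxs image′ injective))
      where
      image′ : ∀ {x′} → x′ ∈ xs → Σ[ y′ ∈ _ ] y′ ∈ (ys ─ y∈ys) × R x′ y′
      image′ {x′} q with image (there q)
      ... | y′ , y′∈ys , Rx′y′ = y′ , ∈-─⁺ ys y∈ys y′∈ys (λ { refl → All.lookup x∉ q (injective Rxy Rx′y′) }) , Rx′y′

    map⁺-injectiveOn : ∀ {B : Set} (f : A → B) {xs} → (∀ {x y} → x ∈ xs → y ∈ xs → f x ≡ f y → x ≡ y) →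
                       Unique xs → Unique (map f xs)
    map⁺-injectiveOn f {[]}     inj []          = []
    map⁺-injectiveOn f {x ∷ xs} inj (x∉ ∷ uxs) =
      All.map⁺ (All.tabulate (λ {y} y∈ fx≡fy → All.lookup x∉ y∈ (inj (here refl) (there y∈) fx≡fy)))
      ∷ map⁺-injectiveOn f (λ p q → inj (there p) (there q)) uxs

    pairs : List A → List (A × A)
    pairs []       = []
    pairs (x ∷ xs) = map (x ,_) xs ++ pairs xs

    length-pairs : ∀ xs → 2 * length (pairs xs) + length xs ≡ length xs * length xs
    length-pairs []       = refl
    length-pairs (x ∷ xs) rewrite length-++ (map (x ,_) xs) {pairs xs} | length-map (x ,_) xs =
      step (length xs) (length (pairs xs)) (length-pairs xs)
      where
      step : ∀ l p → 2 * p + l ≡ l * l → 2 * (l + p) + suc l ≡ suc l * suc l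
      step l p ih = trans (shuffle l p) (trans (cong (_+ (2 * l + 1)) ih) (square l))
        where
        shuffle : ∀ l p → 2 * (l + p) + suc l ≡ (2 * p + l) + (2 * l + 1)
        shuffle = ℕ-Ring.solve-∀
        square : ∀ l → l * l + (2 * l + 1) ≡ suc l * suc l
        square = ℕ-Ring.solve-∀

    ∈-pairs⁻ : ∀ {a b : A} xs → (a , b) ∈ pairs xs → a ∈ xs × b ∈ xs
    ∈-pairs⁻ (x ∷ xs) p with ∈-++⁻ (map (x ,_) xs) p
    ... | inj₁ q with ∈-map⁻ (x ,_) q
    ...   | y , y∈xs , refl = here refl , there y∈xs
    ∈-pairs⁻ (x ∷ xs) p | inj₂ q with ∈-pairs⁻ xs q
    ... | a∈xs , b∈xs = there a∈xs , there b∈xs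

    ∈-pairs⇒R : ∀ {R : A → A → Set} {a b : A} {xs} → AllPairs R xs → (a , b) ∈ pairs xs → R a b
    ∈-pairs⇒R {xs = x ∷ xs} (Rx ∷ Rxs) p with ∈-++⁻ (map (x ,_) xs) p
    ... | inj₁ q with ∈-map⁻ (x ,_) q
    ...   | y , y∈xs , refl = All.lookup Rx y∈xs
    ∈-pairs⇒R {xs = x ∷ xs} (Rx ∷ Rxs) p | inj₂ q = ∈-pairs⇒R Rxs q

    ∈-pairs⁺ : ∀ {R : A → A → Set} {a b : A} {xs} → (∀ {c} → R c c → ⊥) → (∀ {c d} → R c d → R d c → ⊥) →
               AllPairs R xs → a ∈ xs → b ∈ xs → R a b → (a , b) ∈ pairs xs
    ∈-pairs⁺ {xs = x ∷ xs} irr asym (Rx ∷ Rxs) (here refl) (here refl) Rab = ⊥-elim (irr Rab)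
    ∈-pairs⁺ {xs = x ∷ xs} irr asym (Rx ∷ Rxs) (here refl) (there b∈) Rab = ∈-++⁺ˡ (∈-map⁺ (x ,_) b∈)
    ∈-pairs⁺ {xs = x ∷ xs} irr asym (Rx ∷ Rxs) (there a∈) (here refl) Rab = ⊥-elim (asym Rab (All.lookup Rx a∈))
    ∈-pairs⁺ {xs = x ∷ xs} irr asym (Rx ∷ Rxs) (there a∈) (there b∈) Rab =
      ∈-++⁺ʳ (map (x ,_) xs) (∈-pairs⁺ irr asym Rxs a∈ b∈ Rab)

    pairs⁺ : ∀ {xs} → Unique xs → Unique (pairs xs)
    pairs⁺ {[]}     []          = []
    pairs⁺ {x ∷ xs} (x∉ ∷ uxs) =
      Unique.++⁺ (Unique.map⁺ (cong proj₂) uxs) (pairs⁺ uxs) disjoint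
      where
      disjoint : ∀ {p} → p ∈ map (x ,_) xs × p ∈ pairs xs → ⊥
      disjoint (p∈row , p∈pairs) with ∈-map⁻ (x ,_) p∈row
      ... | y , _ , refl = All.lookup x∉ (proj₁ (∈-pairs⁻ xs p∈pairs)) refl

module ListSums where

  open import Data.Nat as ℕ using (ℕ; suc)
  import Data.Nat.Properties as ℕ
  open import Data.Integer as ℤ using (ℤ; +_; _+_; _*_; _-_; _≤_)
  import Data.Integer.Properties as ℤ
  open import Data.Integer.Tactic.RingSolver using (solve-∀)
  open import Data.List using (List; []; _∷_; map; _++_; length)
  open import Data.List.Properties using (length-removeAt′)
  open import Data.List.Membership.Propositional using (_∈_)
  open import Data.List.Relation.Unary.Any using (here; there; _─_)
  open import Data.List.Relation.Unary.All as All using (All)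
  open import Data.List.Relation.Unary.Unique.Propositional using (Unique; []; _∷_)
  open import Data.List.Relation.Binary.Subset.Propositional using (_⊆_)
  open import Relation.Binary.PropositionalEquality
  open Lists using (∈-─⁺; ∈-─⁻)

  private
    suc* : ∀ l b → + suc l * b ≡ b + + l * b
    suc* l b = expand (+ l) b
      where expand : ∀ l b → (+ 1 + l) * b ≡ b + l * b
            expand = solve-∀

  ∑ : ∀ {A : Set} → (A → ℤ) → List A → ℤ
  ∑ f []       = + 0
  ∑ f (x ∷ xs) = f x + ∑ f xs

  module _ {A : Set} where

    ∑-++ : ∀ (f : A → ℤ) xs ys → ∑ f (xs ++ ys) ≡ ∑ f xs + ∑ f ys
    ∑-++ f []       ys = sym (ℤ.+-identityˡ _)
    ∑-++ f (x ∷ xs) ys = trans (cong (_+_ (f x)) (∑-++ f xs ys)) (sym (ℤ.+-assoc (f x) _ _))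

    ∑-map : ∀ {B : Set} (f : B → ℤ) (h : A → B) xs → ∑ f (map h xs) ≡ ∑ (λ x → f (h x)) xs
    ∑-map f h []       = refl
    ∑-map f h (x ∷ xs) = cong (_+_ (f (h x))) (∑-map f h xs)

    ∑-cong : ∀ {f g : A → ℤ} xs → (∀ {x} → x ∈ xs → f x ≡ g x) → ∑ f xs ≡ ∑ g xs
    ∑-cong []       eq = refl
    ∑-cong (x ∷ xs) eq = cong₂ _+_ (eq (here refl)) (∑-cong xs (λ p → eq (there p)))

    ∑-*ˡ : ∀ (c : ℤ) (f : A → ℤ) xs → ∑ (λ x → c * f x) xs ≡ c * ∑ f xs
    ∑-*ˡ c f []       = sym (ℤ.*-zeroʳ c)
    ∑-*ˡ c f (x ∷ xs) = trans (cong (_+_ (c * f x)) (∑-*ˡ c f xs)) (sym (ℤ.*-distribˡ-+ c (f x) _))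

    ∑-affine : ∀ (c d : ℤ) (f : A → ℤ) xs → ∑ (λ x → c * f x - d) xs ≡ c * ∑ f xs - + length xs * d
    ∑-affine c d f []       = sym (empty c d)
      where empty : ∀ c d → c * + 0 - + 0 * d ≡ + 0
            empty = solve-∀
    ∑-affine c d f (x ∷ xs) = trans (cong (_+_ (c * f x - d)) (∑-affine c d f xs)) (step c d (f x) (∑ f xs) (+ length xs))
      where step : ∀ c d y s l → c * y - d + (c * s - l * d) ≡ c * (y + s) - (+ 1 + l) * d
            step = solve-∀

    ∑-centred : ∀ (f : A → ℤ) xs → ∑ (λ x → + length xs * f x - ∑ f xs) xs ≡ + 0
    ∑-centred f xs = trans (∑-affine (+ length xs) (∑ f xs) f xs) (ℤ.+-inverseʳ (+ length xs * ∑ f xs))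

    ∑-≤-length* : ∀ (f : A → ℤ) (b : ℤ) xs → (∀ {x} → x ∈ xs → f x ≤ b) → ∑ f xs ≤ + length xs * b
    ∑-≤-length* f b []       bound = ℤ.+≤+ ℕ.z≤n
    ∑-≤-length* f b (x ∷ xs) bound =
      subst (∑ f (x ∷ xs) ≤_) (sym (suc* (length xs) b))
        (ℤ.+-mono-≤ (bound (here refl)) (∑-≤-length* f b xs (λ p → bound (there p))))

    length*-≤-∑ : ∀ (f : A → ℤ) (b : ℤ) xs → (∀ {x} → x ∈ xs → b ≤ f x) → + length xs * b ≤ ∑ f xs
    length*-≤-∑ f b []       bound = ℤ.+≤+ ℕ.z≤n
    length*-≤-∑ f b (x ∷ xs) bound =
      subst (_≤ ∑ f (x ∷ xs)) (sym (suc* (length xs) b))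
        (ℤ.+-mono-≤ (bound (here refl)) (length*-≤-∑ f b xs (λ p → bound (there p))))

    ∑-nonneg : ∀ (f : A → ℤ) xs → (∀ {x} → x ∈ xs → + 0 ≤ f x) → + 0 ≤ ∑ f xs
    ∑-nonneg f xs nonneg = subst (_≤ ∑ f xs) (ℤ.*-zeroʳ (+ length xs)) (length*-≤-∑ f (+ 0) xs nonneg)

    ∑-─ : ∀ (f : A → ℤ) {x} (ys : List A) (p : x ∈ ys) → ∑ f ys ≡ f x + ∑ f (ys ─ p)
    ∑-─ f (y ∷ ys) (here refl) = refl
    ∑-─ f {x} (y ∷ ys) (there p) = trans (cong (_+_ (f y)) (∑-─ f ys p)) (swap (f y) (f x) (∑ f (ys ─ p)))
      where swap : ∀ a b c → a + (b + c) ≡ b + (a + c)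
            swap = solve-∀

    record Complement (xs ys : List A) : Set where
      field
        rest      : List A
        ∑-split   : ∀ (f : A → ℤ) → ∑ f ys ≡ ∑ f xs + ∑ f rest
        length-split : length ys ≡ length xs ℕ.+ length rest
        rest⊆     : rest ⊆ ys

    complement : ∀ {xs ys} → Unique xs → xs ⊆ ys → Complement xs ys
    complement {[]}     {ys} []          xs⊆ys = record
      { rest = ys ; ∑-split = λ f → sym (ℤ.+-identityˡ _) ; length-split = refl ; rest⊆ = λ q → q }
    complement {x ∷ xs} {ys} (x∉ ∷ uxs) xs⊆ys = record
      { rest         = rest
      ; ∑-split      = λ f → trans (∑-─ f ys x∈ys) (trans (cong (_+_ (f x)) (∑-split f)) (sym (ℤ.+-assoc (f x) _ _)))
      ; length-split = trans (length-removeAt′ ys _) (cong suc length-split)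
      ; rest⊆        = λ q → ∈-─⁻ ys x∈ys (rest⊆ q)
      }
      where
      x∈ys = xs⊆ys (here refl)
      xs⊆ys─x : xs ⊆ (ys ─ x∈ys)
      xs⊆ys─x q = ∈-─⁺ ys x∈ys (xs⊆ys (there q)) (λ { refl → All.lookup x∉ q refl })
      open Complement (complement uxs xs⊆ys─x)

    ∣∑∣≤length* : ∀ (f : A → ℤ) (r : ℕ) xs → (∀ {x} → x ∈ xs → ℤ.∣ f x ∣ ℕ.≤ r) → ℤ.∣ ∑ f xs ∣ ℕ.≤ length xs ℕ.* r
    ∣∑∣≤length* f r []       bound = ℕ.z≤n
    ∣∑∣≤length* f r (x ∷ xs) bound =
      ℕ.≤-trans (ℤ.∣i+j∣≤∣i∣+∣j∣ (f x) (∑ f xs)) (ℕ.+-mono-≤ (bound (here refl)) (∣∑∣≤length* f r xs (λ p → bound (there p))))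

    ∑-neg : ∀ (f : A → ℤ) xs → ∑ (λ x → ℤ.- f x) xs ≡ ℤ.- ∑ f xs
    ∑-neg f []       = refl
    ∑-neg f (x ∷ xs) = trans (cong (_+_ (ℤ.- f x)) (∑-neg f xs)) (sym (ℤ.neg-distrib-+ (f x) (∑ f xs)))

module PairSums where

  open import Data.Nat as ℕ using (ℕ)
  import Data.Nat.Properties as ℕ
  open import Data.Integer as ℤ using (ℤ; +_; _+_; _*_; _-_; -_; _≤_)
  import Data.Integer.Properties as ℤ
  open import Data.Integer.Tactic.RingSolver using (solve-∀)
  open import Data.List using (List; []; _∷_; map; length)
  open import Data.Product using (_,_; proj₁; proj₂)
  open import Relation.Binary.PropositionalEquality
  open ListSums
  open Integers
  open Lists

  module _ {A : Set} (a : A → ℤ) where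

    S₁ S₂ S₃ S₄ : List A → ℤ
    S₁ = ∑ a
    S₂ = ∑ (λ x → a x * a x)
    S₃ = ∑ (λ x → a x * a x * a x)
    S₄ = ∑ (λ x → a x * a x * a x * a x)

    quartic : (c₀ c₁ c₂ c₃ c₄ w : ℤ) → ℤ
    quartic c₀ c₁ c₂ c₃ c₄ w = c₀ + c₁ * w + c₂ * (w * w) + c₃ * (w * w * w) + c₄ * (w * w * w * w)

    ∑-quartic : ∀ c₀ c₁ c₂ c₃ c₄ xs → ∑ (λ y → quartic c₀ c₁ c₂ c₃ c₄ (a y)) xs
                ≡ c₀ * + length xs + c₁ * S₁ xs + c₂ * S₂ xs + c₃ * S₃ xs + c₄ * S₄ xs
    ∑-quartic c₀ c₁ c₂ c₃ c₄ []       = sym (empty c₀ c₁ c₂ c₃ c₄)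
      where empty : ∀ c₀ c₁ c₂ c₃ c₄ → c₀ * + 0 + c₁ * + 0 + c₂ * + 0 + c₃ * + 0 + c₄ * + 0 ≡ + 0
            empty = solve-∀
    ∑-quartic c₀ c₁ c₂ c₃ c₄ (x ∷ xs) =
      trans (cong (_+_ (quartic c₀ c₁ c₂ c₃ c₄ (a x))) (∑-quartic c₀ c₁ c₂ c₃ c₄ xs))
            (step c₀ c₁ c₂ c₃ c₄ (a x) (+ length xs) (S₁ xs) (S₂ xs) (S₃ xs) (S₄ xs))
      where
      step : ∀ c₀ c₁ c₂ c₃ c₄ w l s₁ s₂ s₃ s₄ →
        c₀ + c₁ * w + c₂ * (w * w) + c₃ * (w * w * w) + c₄ * (w * w * w * w)
          + (c₀ * l + c₁ * s₁ + c₂ * s₂ + c₃ * s₃ + c₄ * s₄)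
        ≡ c₀ * (+ 1 + l) + c₁ * (w + s₁) + c₂ * (w * w + s₂) + c₃ * (w * w * w + s₃) + c₄ * (w * w * w * w + s₄)
      step = solve-∀

    pairSum : (ℤ → ℤ → ℤ) → List A → ℤ
    pairSum F xs = ∑ (λ p → F (a (proj₁ p)) (a (proj₂ p))) (pairs xs)

    pairSum-∷ : ∀ F x xs → pairSum F (x ∷ xs) ≡ ∑ (λ y → F (a x) (a y)) xs + pairSum F xs
    pairSum-∷ F x xs = trans (∑-++ _ (map (x ,_) xs) (pairs xs)) (cong (_+ pairSum F xs) (∑-map _ (x ,_) xs))

    pairSum-∷-quartic : ∀ F x xs {r} c₀ c₁ c₂ c₃ c₄ → (∀ w → F (a x) w ≡ quartic c₀ c₁ c₂ c₃ c₄ w) → pairSum F xs ≡ r →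
      pairSum F (x ∷ xs) ≡ c₀ * + length xs + c₁ * S₁ xs + c₂ * S₂ xs + c₃ * S₃ xs + c₄ * S₄ xs + r
    pairSum-∷-quartic F x xs c₀ c₁ c₂ c₃ c₄ expand ih =
      trans (pairSum-∷ F x xs) (cong₂ _+_ (trans (∑-cong xs (λ {y} _ → expand (a y))) (∑-quartic c₀ c₁ c₂ c₃ c₄ xs)) ih)

  sum¹ sum² sum⁴ squareDiff² : ℤ → ℤ → ℤ
  sum¹ u v = u + v
  sum² u v = (u + v) * (u + v)
  sum⁴ u v = sum² u v * sum² u v
  squareDiff² u v = (u * u - v * v) * (u * u - v * v)

  module _ {A : Set} (a : A → ℤ) where

    pairSum-sum¹ : ∀ xs → pairSum a sum¹ xs ≡ (+ length xs - + 1) * S₁ a xs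
    pairSum-sum¹ []       = refl
    pairSum-sum¹ (x ∷ xs) =
      trans (pairSum-∷-quartic a sum¹ x xs (a x) (+ 1) (+ 0) (+ 0) (+ 0) (expand (a x)) (pairSum-sum¹ xs))
            (step (a x) (+ length xs) (S₁ a xs) (S₂ a xs) (S₃ a xs) (S₄ a xs))
      where
      expand : ∀ u w → u + w ≡ u + + 1 * w + + 0 * (w * w) + + 0 * (w * w * w) + + 0 * (w * w * w * w)
      expand = solve-∀
      step : ∀ u l s₁ s₂ s₃ s₄ → u * l + + 1 * s₁ + + 0 * s₂ + + 0 * s₃ + + 0 * s₄ + (l - + 1) * s₁ ≡ (+ 1 + l - + 1) * (u + s₁)
      step = solve-∀

    pairSum-sum² : ∀ xs → pairSum a sum² xs ≡ (+ length xs - + 2) * S₂ a xs + S₁ a xs * S₁ a xs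
    pairSum-sum² []       = refl
    pairSum-sum² (x ∷ xs) =
      trans (pairSum-∷-quartic a sum² x xs (a x * a x) (+ 2 * a x) (+ 1) (+ 0) (+ 0) (expand (a x)) (pairSum-sum² xs))
            (step (a x) (+ length xs) (S₁ a xs) (S₂ a xs) (S₃ a xs) (S₄ a xs))
      where
      expand : ∀ u w → (u + w) * (u + w) ≡ u * u + + 2 * u * w + + 1 * (w * w) + + 0 * (w * w * w) + + 0 * (w * w * w * w)
      expand = solve-∀
      step : ∀ u l s₁ s₂ s₃ s₄ → u * u * l + + 2 * u * s₁ + + 1 * s₂ + + 0 * s₃ + + 0 * s₄ + ((l - + 2) * s₂ + s₁ * s₁)
             ≡ (+ 1 + l - + 2) * (u * u + s₂) + (u + s₁) * (u + s₁)
      step = solve-∀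

    pairSum-sum⁴ : ∀ xs → pairSum a sum⁴ xs ≡ (+ length xs - + 8) * S₄ a xs + + 4 * S₁ a xs * S₃ a xs + + 3 * S₂ a xs * S₂ a xs
    pairSum-sum⁴ []       = refl
    pairSum-sum⁴ (x ∷ xs) =
      trans (pairSum-∷-quartic a sum⁴ x xs (a x * a x * a x * a x) (+ 4 * (a x * a x * a x)) (+ 6 * (a x * a x)) (+ 4 * a x) (+ 1)
                               (expand (a x)) (pairSum-sum⁴ xs))
            (step (a x) (+ length xs) (S₁ a xs) (S₂ a xs) (S₃ a xs) (S₄ a xs))
      where
      expand : ∀ u w → (u + w) * (u + w) * ((u + w) * (u + w))
                       ≡ u * u * u * u + + 4 * (u * u * u) * w + + 6 * (u * u) * (w * w) + + 4 * u * (w * w * w) + + 1 * (w * w * w * w)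
      expand = solve-∀
      step : ∀ u l s₁ s₂ s₃ s₄ → u * u * u * u * l + + 4 * (u * u * u) * s₁ + + 6 * (u * u) * s₂ + + 4 * u * s₃ + + 1 * s₄
             + ((l - + 8) * s₄ + + 4 * s₁ * s₃ + + 3 * s₂ * s₂)
             ≡ (+ 1 + l - + 8) * (u * u * u * u + s₄) + + 4 * (u + s₁) * (u * u * u + s₃) + + 3 * (u * u + s₂) * (u * u + s₂)
      step = solve-∀

    pairSum-squareDiff² : ∀ xs → pairSum a squareDiff² xs ≡ + length xs * S₄ a xs - S₂ a xs * S₂ a xs
    pairSum-squareDiff² []       = refl
    pairSum-squareDiff² (x ∷ xs) =
      trans (pairSum-∷-quartic a squareDiff² x xs (a x * a x * (a x * a x)) (+ 0) (- (+ 2 * (a x * a x))) (+ 0) (+ 1) (expand (a x)) (pairSum-squareDiff² xs))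
            (step (a x) (+ length xs) (S₁ a xs) (S₂ a xs) (S₃ a xs) (S₄ a xs))
      where
      expand : ∀ u w → (u * u - w * w) * (u * u - w * w) ≡ u * u * (u * u) + + 0 * w + - (+ 2 * (u * u)) * (w * w) + + 0 * (w * w * w) + + 1 * (w * w * w * w)
      expand = solve-∀
      step : ∀ u l s₁ s₂ s₃ s₄ → u * u * (u * u) * l + + 0 * s₁ + - (+ 2 * (u * u)) * s₂ + + 0 * s₃ + + 1 * s₄
             + (l * s₄ - s₂ * s₂)
             ≡ (+ 1 + l) * (u * u * u * u + s₄) - (u * u + s₂) * (u * u + s₂)
      step = solve-∀

    module _ (xs : List A) (centred : S₁ a xs ≡ + 0) where

      pairSum-sum¹-centred : pairSum a sum¹ xs ≡ + 0
      pairSum-sum¹-centred rewrite pairSum-sum¹ xs | centred = ℤ.*-zeroʳ (+ length xs - + 1)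

      pairSum-sum²-centred : pairSum a sum² xs ≡ (+ length xs - + 2) * S₂ a xs
      pairSum-sum²-centred rewrite pairSum-sum² xs | centred = ℤ.+-identityʳ ((+ length xs - + 2) * S₂ a xs)

      pairSum-sum⁴-centred : pairSum a sum⁴ xs ≡ (+ length xs - + 8) * S₄ a xs + + 3 * S₂ a xs * S₂ a xs
      pairSum-sum⁴-centred rewrite pairSum-sum⁴ xs | centred =
        drop ((+ length xs - + 8) * S₄ a xs) (S₃ a xs) (+ 3 * S₂ a xs * S₂ a xs)
        where drop : ∀ x y s → x + + 4 * + 0 * y + s ≡ x + s
              drop = solve-∀

      -- with C = ∑ (a u² − a v²)² ≥ 0:  t² P₄ = 4 P₂² + (t − 2)(t − 8) C + 2 t P₄
      pairMoment-inequality : 8 ℕ.≤ length xs →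
        + 4 * (pairSum a sum² xs * pairSum a sum² xs) ≤ + length xs * + length xs * pairSum a sum⁴ xs
      pairMoment-inequality 8≤t = subst (+ 4 * (P₂ * P₂) ≤_) identity (≤-+-nonneg _ remainder-nonneg)
        where
        T = + length xs
        P₂ = pairSum a sum² xs
        P₄ = pairSum a sum⁴ xs
        C = pairSum a squareDiff² xs
        P₄-nonneg : + 0 ≤ P₄
        P₄-nonneg = ∑-nonneg _ (pairs xs) (λ {p} _ → square-nonneg (sum² (a (proj₁ p)) (a (proj₂ p))))
        C-nonneg : + 0 ≤ C
        C-nonneg = ∑-nonneg _ (pairs xs) (λ {p} _ → square-nonneg (a (proj₁ p) * a (proj₁ p) - a (proj₂ p) * a (proj₂ p)))
        remainder-nonneg : + 0 ≤ (T - + 2) * (T - + 8) * C + + 2 * T * P₄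
        remainder-nonneg = +-nonneg (*-nonneg (*-nonneg (0≤T-c (ℕ.≤-trans (ℕ.≤ᵇ⇒≤ 2 8 _) 8≤t)) (0≤T-c 8≤t)) C-nonneg)
                                    (*-nonneg {+ 2 * T} (*-nonneg {+ 2} {T} (ℤ.+≤+ ℕ.z≤n) (ℤ.+≤+ ℕ.z≤n)) P₄-nonneg)
          where 0≤T-c : ∀ {c} → c ℕ.≤ length xs → + 0 ≤ T - + c
                0≤T-c c≤t = ℤ.i≤j⇒0≤j-i (ℤ.+≤+ c≤t)
        identity : + 4 * (P₂ * P₂) + ((T - + 2) * (T - + 8) * C + + 2 * T * P₄) ≡ T * T * P₄
        identity rewrite pairSum-sum²-centred | pairSum-sum⁴-centred | pairSum-squareDiff² xs = ring T (S₂ a xs) (S₄ a xs)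
          where
          ring : ∀ T s₂ s₄ → + 4 * ((T - + 2) * s₂ * ((T - + 2) * s₂)) + ((T - + 2) * (T - + 8) * (T * s₄ - s₂ * s₂)
                   + + 2 * T * ((T - + 8) * s₄ + + 3 * s₂ * s₂)) ≡ T * T * ((T - + 8) * s₄ + + 3 * s₂ * s₂)
          ring = solve-∀

module IntervalSums where

  open import Data.Nat as ℕ using (ℕ; zero; suc)
  import Data.Nat.Properties as ℕ
  open import Data.Integer as ℤ using (ℤ; +_; _+_; _*_; _-_; ∣_∣)
  import Data.Integer.Properties as ℤ
  open import Data.Integer.Tactic.RingSolver using (solve-∀)
  import Data.Nat.Tactic.RingSolver as ℕ-Ring
  open import Data.List using (List; []; _∷_; length)
  open import Data.List.Membership.Propositional using (_∈_)
  open import Data.List.Relation.Unary.Any using (here; there)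
  open import Data.List.Relation.Unary.All as All using ()
  open import Data.List.Relation.Unary.Unique.Propositional using (Unique; []; _∷_)
  open import Data.Product using (_×_; _,_; proj₁)
  open import Data.Empty using (⊥-elim)
  open import Relation.Nullary using (yes; no)
  open import Relation.Binary.PropositionalEquality
  open ListSums
  open Integers

  interval : ℕ → ℕ → List ℕ
  interval a zero    = []
  interval a (suc e) = a ∷ interval (suc a) e

  length-interval : ∀ a e → length (interval a e) ≡ e
  length-interval a zero    = refl
  length-interval a (suc e) = cong suc (length-interval (suc a) e)

  ∈-interval⁻ : ∀ {x} a e → x ∈ interval a e → a ℕ.≤ x × x ℕ.< a ℕ.+ e
  ∈-interval⁻ a (suc e) (here refl) = ℕ.≤-refl , ℕ.m<m+n a (ℕ.s≤s ℕ.z≤n)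
  ∈-interval⁻ {x} a (suc e) (there p) with ∈-interval⁻ (suc a) e p
  ... | a<x , x<a+1+e = ℕ.<⇒≤ a<x , subst (x ℕ.<_) (sym (ℕ.+-suc a e)) x<a+1+e

  ∈-interval⁺ : ∀ {x} a e → a ℕ.≤ x → x ℕ.< a ℕ.+ e → x ∈ interval a e
  ∈-interval⁺ {x} a zero    a≤x x<a+0 = ⊥-elim (ℕ.<⇒≱ (subst (x ℕ.<_) (ℕ.+-identityʳ a) x<a+0) a≤x)
  ∈-interval⁺ {x} a (suc e) a≤x x<a+1+e with a ℕ.≟ x
  ... | yes refl = here refl
  ... | no a≢x   = there (∈-interval⁺ (suc a) e (ℕ.≤∧≢⇒< a≤x a≢x) (subst (x ℕ.<_) (ℕ.+-suc a e) x<a+1+e))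

  interval⁺ : ∀ a e → Unique (interval a e)
  interval⁺ a zero    = []
  interval⁺ a (suc e) = All.tabulate (λ q a≡x → ℕ.<-irrefl a≡x (proj₁ (∈-interval⁻ (suc a) e q))) ∷ interval⁺ (suc a) e

  -- endSum a e = affine a + affine (a + e − 1)
  module _ (t k : ℤ) where

    affine : ℕ → ℤ
    affine x = t * + x - k

    affine² affine⁴ : ℕ → ℤ
    affine² x = affine x * affine x
    affine⁴ x = affine² x * affine² x

    endSum : ℕ → ℕ → ℤ
    endSum a e = + 2 * (t * + a - k) + t * (+ e - + 1)

    ∑affine-interval : ∀ a e → + 2 * ∑ affine (interval a e) ≡ + e * endSum a e
    ∑affine-interval a zero    = sym (empty t k (+ a))
      where empty : ∀ t k a → + 0 * (+ 2 * (t * a - k) + t * (+ 0 - + 1)) ≡ + 0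
            empty = solve-∀
    ∑affine-interval a (suc e) =
      trans (ℤ.*-distribˡ-+ (+ 2) (affine a) _)
            (trans (cong (_+_ (+ 2 * affine a)) (∑affine-interval (suc a) e)) (step t k (+ a) (+ e)))
      where
      step : ∀ t k a e → + 2 * (t * a - k) + e * (+ 2 * (t * (+ 1 + a) - k) + t * (e - + 1))
                         ≡ (+ 1 + e) * (+ 2 * (t * a - k) + t * ((+ 1 + e) - + 1))
      step = solve-∀

    ∑affine²-interval : ∀ a e → + 12 * ∑ affine² (interval a e)
                        ≡ t * t * + e * (+ e * + e - + 1) + + 3 * + e * (endSum a e * endSum a e)
    ∑affine²-interval a zero    = sym (empty t k (+ a))
      where empty : ∀ t k a → let u = + 2 * (t * a - k) + t * (+ 0 - + 1) in
                      t * t * + 0 * (+ 0 * + 0 - + 1) + + 3 * + 0 * (u * u) ≡ + 0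
            empty = solve-∀
    ∑affine²-interval a (suc e) =
      trans (ℤ.*-distribˡ-+ (+ 12) (affine² a) _)
            (trans (cong (_+_ (+ 12 * affine² a)) (∑affine²-interval (suc a) e)) (step t k (+ a) (+ e)))
      where
      step : ∀ t k a e → let w = t * a - k ; u′ = + 2 * (t * (+ 1 + a) - k) + t * (e - + 1)
                             u = + 2 * (t * a - k) + t * ((+ 1 + e) - + 1) in
             + 12 * (w * w) + (t * t * e * (e * e - + 1) + + 3 * e * (u′ * u′))
             ≡ t * t * (+ 1 + e) * ((+ 1 + e) * (+ 1 + e) - + 1) + + 3 * (+ 1 + e) * (u * u)
      step = solve-∀

    ∑affine⁴-interval : ∀ a e → + 240 * ∑ affine⁴ (interval a e)
                        ≡ t * t * (t * t) * + e * (+ e * + e - + 1) * (+ 3 * (+ e * + e) - + 7)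
                          + + 30 * (t * t) * (endSum a e * endSum a e) * + e * (+ e * + e - + 1)
                          + + 15 * + e * (endSum a e * endSum a e * (endSum a e * endSum a e))
    ∑affine⁴-interval a zero    = sym (empty t k (+ a))
      where empty : ∀ t k a → let u = + 2 * (t * a - k) + t * (+ 0 - + 1) in
                      t * t * (t * t) * + 0 * (+ 0 * + 0 - + 1) * (+ 3 * (+ 0 * + 0) - + 7)
                      + + 30 * (t * t) * (u * u) * + 0 * (+ 0 * + 0 - + 1) + + 15 * + 0 * (u * u * (u * u)) ≡ + 0
            empty = solve-∀
    ∑affine⁴-interval a (suc e) =
      trans (ℤ.*-distribˡ-+ (+ 240) (affine⁴ a) _)
            (trans (cong (_+_ (+ 240 * affine⁴ a)) (∑affine⁴-interval (suc a) e)) (step t k (+ a) (+ e)))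
      where
      step : ∀ t k a e → let w = t * a - k ; u′ = + 2 * (t * (+ 1 + a) - k) + t * (e - + 1)
                             u = + 2 * (t * a - k) + t * ((+ 1 + e) - + 1) in
             + 240 * (w * w * (w * w))
               + (t * t * (t * t) * e * (e * e - + 1) * (+ 3 * (e * e) - + 7)
                  + + 30 * (t * t) * (u′ * u′) * e * (e * e - + 1) + + 15 * e * (u′ * u′ * (u′ * u′)))
             ≡ t * t * (t * t) * (+ 1 + e) * ((+ 1 + e) * (+ 1 + e) - + 1) * (+ 3 * ((+ 1 + e) * (+ 1 + e)) - + 7)
               + + 30 * (t * t) * (u * u) * (+ 1 + e) * ((+ 1 + e) * (+ 1 + e) - + 1) + + 15 * (+ 1 + e) * (u * u * (u * u))
      step = solve-∀

    twice-affine-endSum : ∀ a e i → + 2 * affine (a ℕ.+ i) - endSum a (suc e) ≡ t * (+ (2 ℕ.* i) - + e)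
    twice-affine-endSum a e i = trans (ring t k (+ a) (+ i) (+ e)) (cong (λ j → t * (j - + e)) (sym (ℤ.pos-* 2 i)))
      where ring : ∀ t k a i e → + 2 * (t * (a + i) - k) - (+ 2 * (t * a - k) + t * ((+ 1 + e) - + 1)) ≡ t * (+ 2 * i - e)
            ring = solve-∀

    ∣twice-affine-endSum∣≤ : ∀ {x} a e → x ∈ interval a e → ∣ + 2 * affine x - endSum a e ∣ ℕ.≤ ∣ t ∣ ℕ.* (e ℕ.∸ 1)
    ∣twice-affine-endSum∣≤ {x} a (suc e) x∈ with ∈-interval⁻ a (suc e) x∈
    ... | a≤x , x<a+1+e = subst (λ y → ∣ + 2 * affine y - endSum a (suc e) ∣ ℕ.≤ ∣ t ∣ ℕ.* e) (ℕ.m+[n∸m]≡n a≤x)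
      (subst (ℕ._≤ ∣ t ∣ ℕ.* e) (sym (trans (cong ∣_∣ (twice-affine-endSum a e i)) (ℤ.abs-* t _)))
             (ℕ.*-monoʳ-≤ ∣ t ∣ (∣2i-n∣≤n i≤e)))
      where
      i = x ℕ.∸ a
      i≤e : i ℕ.≤ e
      i≤e = ℕ.≤-pred (ℕ.+-cancelˡ-< a i (suc e) (subst (ℕ._< a ℕ.+ suc e) (sym (ℕ.m+[n∸m]≡n a≤x)) x<a+1+e))

    -- The closed forms in ℕ, for lengths 2 + e (so that no subtraction remains) and with the negative terms dropped.
    ∑affine⁴-interval-≤ : ∀ a E → 2 ℕ.≤ E → let τ = ∣ t ∣ ; u = ∣ endSum a E ∣ in
      240 ℕ.* ∣ ∑ affine⁴ (interval a E) ∣ ℕ.≤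
        3 ℕ.* (τ ℕ.* τ ℕ.* (τ ℕ.* τ)) ℕ.* (E ℕ.* E ℕ.* (E ℕ.* E) ℕ.* E)
        ℕ.+ 30 ℕ.* (τ ℕ.* τ) ℕ.* (u ℕ.* u) ℕ.* (E ℕ.* E ℕ.* E) ℕ.+ 15 ℕ.* E ℕ.* (u ℕ.* u ℕ.* (u ℕ.* u))
    ∑affine⁴-interval-≤ a E@(suc (suc e)) (ℕ.s≤s (ℕ.s≤s ℕ.z≤n)) =
      ℕ.≤-trans (ℕ.≤-reflexive 240y≡poly) (ℕ.≤-trans (ℕ.m≤m+n ⟦ poly ⟧ℕ _) (ℕ.≤-reflexive (dominate τ e u)))
      where
      τ = ∣ t ∣
      U = endSum a E
      u = ∣ U ∣
      poly : Poly
      poly = ‵ τ ‵* ‵ τ ‵* (‵ τ ‵* ‵ τ) ‵* (‵ 2 ‵+ ‵ e) ‵* (‵ e ‵* ‵ e ‵+ ‵ 4 ‵* ‵ e ‵+ ‵ 3) ‵* (‵ 3 ‵* ‵ e ‵* ‵ e ‵+ ‵ 12 ‵* ‵ e ‵+ ‵ 5)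
             ‵+ ‵ 30 ‵* (‵ τ ‵* ‵ τ) ‵* (‵ u ‵* ‵ u) ‵* (‵ 2 ‵+ ‵ e) ‵* (‵ e ‵* ‵ e ‵+ ‵ 4 ‵* ‵ e ‵+ ‵ 3)
             ‵+ ‵ 15 ‵* (‵ 2 ‵+ ‵ e) ‵* (‵ u ‵* ‵ u ‵* (‵ u ‵* ‵ u))
      closed : ℤ → ℤ → ℤ
      closed tt uu = tt * tt * + E * (+ E * + E - + 1) * (+ 3 * (+ E * + E) - + 7)
                     + + 30 * tt * uu * + E * (+ E * + E - + 1) + + 15 * + E * (uu * uu)
      expand : ∀ τ e u →
        τ * τ * (τ * τ) * (+ 2 + e) * ((+ 2 + e) * (+ 2 + e) - + 1) * (+ 3 * ((+ 2 + e) * (+ 2 + e)) - + 7)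
          + + 30 * (τ * τ) * (u * u) * (+ 2 + e) * ((+ 2 + e) * (+ 2 + e) - + 1) + + 15 * (+ 2 + e) * (u * u * (u * u))
        ≡ τ * τ * (τ * τ) * (+ 2 + e) * (e * e + + 4 * e + + 3) * (+ 3 * e * e + + 12 * e + + 5)
          + + 30 * (τ * τ) * (u * u) * (+ 2 + e) * (e * e + + 4 * e + + 3) + + 15 * (+ 2 + e) * (u * u * (u * u))
      expand = solve-∀
      240y≡poly : 240 ℕ.* ∣ ∑ affine⁴ (interval a E) ∣ ≡ ⟦ poly ⟧ℕ
      240y≡poly = ⟦⟧ℤ-≡⇒⟦⟧ℕ-≡ (‵ 240 ‵* ‵ ∣ ∑ affine⁴ (interval a E) ∣) poly (begin
        + 240 * + ∣ ∑ affine⁴ (interval a E) ∣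
          ≡⟨ cong (+ 240 *_) (ℤ.0≤i⇒+∣i∣≡i (∑-nonneg _ (interval a E) (λ {x} _ → square-nonneg (affine² x)))) ⟩
        + 240 * ∑ affine⁴ (interval a E)    ≡⟨ ∑affine⁴-interval a E ⟩
        closed (t * t) (U * U)             ≡⟨ cong₂ closed (square-∣∣ t) (square-∣∣ U) ⟩
        closed (+ τ * + τ) (+ u * + u)     ≡⟨ expand (+ τ) (+ e) (+ u) ⟩
        ⟦ poly ⟧ℤ                          ∎)
        where open ≡-Reasoning
      dominate : ∀ τ e u →
        τ ℕ.* τ ℕ.* (τ ℕ.* τ) ℕ.* (2 ℕ.+ e) ℕ.* (e ℕ.* e ℕ.+ 4 ℕ.* e ℕ.+ 3) ℕ.* (3 ℕ.* e ℕ.* e ℕ.+ 12 ℕ.* e ℕ.+ 5)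
          ℕ.+ 30 ℕ.* (τ ℕ.* τ) ℕ.* (u ℕ.* u) ℕ.* (2 ℕ.+ e) ℕ.* (e ℕ.* e ℕ.+ 4 ℕ.* e ℕ.+ 3)
          ℕ.+ 15 ℕ.* (2 ℕ.+ e) ℕ.* (u ℕ.* u ℕ.* (u ℕ.* u))
          ℕ.+ (τ ℕ.* τ ℕ.* (τ ℕ.* τ) ℕ.* (2 ℕ.+ e) ℕ.* (10 ℕ.* e ℕ.* e ℕ.+ 40 ℕ.* e ℕ.+ 33)
               ℕ.+ 30 ℕ.* (τ ℕ.* τ) ℕ.* (u ℕ.* u) ℕ.* (2 ℕ.+ e))
        ≡ 3 ℕ.* (τ ℕ.* τ ℕ.* (τ ℕ.* τ)) ℕ.* ((2 ℕ.+ e) ℕ.* (2 ℕ.+ e) ℕ.* ((2 ℕ.+ e) ℕ.* (2 ℕ.+ e)) ℕ.* (2 ℕ.+ e))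
          ℕ.+ 30 ℕ.* (τ ℕ.* τ) ℕ.* (u ℕ.* u) ℕ.* ((2 ℕ.+ e) ℕ.* (2 ℕ.+ e) ℕ.* (2 ℕ.+ e))
          ℕ.+ 15 ℕ.* (2 ℕ.+ e) ℕ.* (u ℕ.* u ℕ.* (u ℕ.* u))
      dominate = ℕ-Ring.solve-∀

    ∑affine²-interval-≥ : ∀ a E → 2 ℕ.≤ E → let τ = ∣ t ∣ in
      τ ℕ.* τ ℕ.* (E ℕ.* E ℕ.* E) ℕ.≤ 12 ℕ.* ∣ ∑ affine² (interval a E) ∣ ℕ.+ τ ℕ.* τ ℕ.* E
    ∑affine²-interval-≥ a E@(suc (suc e)) (ℕ.s≤s (ℕ.s≤s ℕ.z≤n)) =
      ℕ.≤-trans (ℕ.≤-reflexive (split τ e))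
        (ℕ.+-monoˡ-≤ (τ ℕ.* τ ℕ.* E) (ℕ.≤-trans (ℕ.m≤m+n _ (3 ℕ.* (2 ℕ.+ e) ℕ.* (u ℕ.* u))) (ℕ.≤-reflexive (sym 12y≡poly))))
      where
      τ = ∣ t ∣
      U = endSum a E
      u = ∣ U ∣
      poly : Poly
      poly = ‵ τ ‵* ‵ τ ‵* (‵ 2 ‵+ ‵ e) ‵* (‵ e ‵* ‵ e ‵+ ‵ 4 ‵* ‵ e ‵+ ‵ 3) ‵+ ‵ 3 ‵* (‵ 2 ‵+ ‵ e) ‵* (‵ u ‵* ‵ u)
      closed : ℤ → ℤ → ℤ
      closed tt uu = tt * + E * (+ E * + E - + 1) + + 3 * + E * uu
      expand : ∀ τ e u → τ * τ * (+ 2 + e) * ((+ 2 + e) * (+ 2 + e) - + 1) + + 3 * (+ 2 + e) * (u * u)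
                         ≡ τ * τ * (+ 2 + e) * (e * e + + 4 * e + + 3) + + 3 * (+ 2 + e) * (u * u)
      expand = solve-∀
      12y≡poly : 12 ℕ.* ∣ ∑ affine² (interval a E) ∣ ≡ ⟦ poly ⟧ℕ
      12y≡poly = ⟦⟧ℤ-≡⇒⟦⟧ℕ-≡ (‵ 12 ‵* ‵ ∣ ∑ affine² (interval a E) ∣) poly (begin
        + 12 * + ∣ ∑ affine² (interval a E) ∣
          ≡⟨ cong (+ 12 *_) (ℤ.0≤i⇒+∣i∣≡i (∑-nonneg _ (interval a E) (λ {x} _ → square-nonneg (affine x)))) ⟩
        + 12 * ∑ affine² (interval a E)     ≡⟨ ∑affine²-interval a E ⟩
        closed (t * t) (U * U)             ≡⟨ cong₂ closed (square-∣∣ t) (square-∣∣ U) ⟩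
        closed (+ τ * + τ) (+ u * + u)     ≡⟨ expand (+ τ) (+ e) (+ u) ⟩
        ⟦ poly ⟧ℤ                          ∎)
        where open ≡-Reasoning
      split : ∀ τ e → τ ℕ.* τ ℕ.* ((2 ℕ.+ e) ℕ.* (2 ℕ.+ e) ℕ.* (2 ℕ.+ e))
                      ≡ τ ℕ.* τ ℕ.* (2 ℕ.+ e) ℕ.* (e ℕ.* e ℕ.+ 4 ℕ.* e ℕ.+ 3) ℕ.+ τ ℕ.* τ ℕ.* (2 ℕ.+ e)
      split = ℕ-Ring.solve-∀

module Estimates where

  open import Data.Nat
  open import Data.Nat.Properties
  import Data.Nat.Tactic.RingSolver as ℕ-Ring
  open import Data.Empty using (⊥)
  open import Data.List using (_∷_; [])
  open import Relation.Binary.PropositionalEquality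

  open ≤-Reasoning

  private
    *-mono₃-≤ : ∀ {a a′ b b′ c c′} → a ≤ a′ → b ≤ b′ → c ≤ c′ → a * b * c ≤ a′ * b′ * c′
    *-mono₃-≤ p q r = *-mono-≤ (*-mono-≤ p q) r

  module _ {α t E U : ℕ} (1≤α : 1 ≤ α) (20000α≤t : 20000 * α ≤ t) (t²≤4E : t * t ≤ 4 * E) (U≤8αt² : U ≤ 8 * α * (t * t)) where

    t²E³ : ℕ
    t²E³ = t * t * (E * E * E)

    private
      5000αt≤E : 5000 * α * t ≤ E
      5000αt≤E = *-cancelˡ-≤ 4 (begin
        4 * (5000 * α * t) ≡⟨ ℕ-Ring.solve (α ∷ t ∷ []) ⟩
        20000 * α * t     ≤⟨ *-monoˡ-≤ t 20000α≤t ⟩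
        t * t             ≤⟨ t²≤4E ⟩
        4 * E             ∎)

      5000t≤E : 5000 * t ≤ E
      5000t≤E = ≤-trans (*-monoˡ-≤ t (*-monoʳ-≤ 5000 1≤α)) 5000αt≤E

      1≤t : 1 ≤ t
      1≤t = ≤-trans (≤ᵇ⇒≤ 1 20000 _) (≤-trans (*-monoʳ-≤ 20000 1≤α) 20000α≤t)

      5000≤E : 5000 ≤ E
      5000≤E = ≤-trans (*-monoʳ-≤ 5000 1≤t) 5000t≤E

      1≤E : 1 ≤ E
      1≤E = ≤-trans (≤ᵇ⇒≤ 1 5000 _) 5000≤E

      0<t²E³ : 0 < t²E³
      0<t²E³ = *-mono-≤ (*-mono-≤ 1≤t 1≤t) (*-mono-≤ (*-mono-≤ 1≤E 1≤E) 1≤E)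

      U≤tE : U ≤ t * E
      U≤tE = begin
        U                    ≤⟨ U≤8αt² ⟩
        8 * α * (t * t)      ≡⟨ ℕ-Ring.solve (α ∷ t ∷ []) ⟩
        t * (8 * α * t)      ≤⟨ *-monoʳ-≤ t (≤-trans (*-monoˡ-≤ t (*-monoˡ-≤ α (≤ᵇ⇒≤ 8 5000 _))) 5000αt≤E) ⟩
        t * E                ∎

      U²-bound : ∀ c f → 4 * c * (8 * 8) ≤ f * 5000 * 5000 → c * (U * U) ≤ f * (E * E * E)
      U²-bound c f constants = *-cancelˡ-≤ 4 (begin
        4 * (c * (U * U))                                          ≤⟨ *-monoʳ-≤ 4 (*-monoʳ-≤ c (*-mono-≤ U≤8αt² U≤8αt²)) ⟩
        4 * (c * ((8 * α * (t * t)) * (8 * α * (t * t))))          ≡⟨ ℕ-Ring.solve (c ∷ α ∷ t ∷ []) ⟩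
        4 * c * (8 * 8) * (α * t * (α * t) * (t * t))              ≤⟨ *-monoˡ-≤ (α * t * (α * t) * (t * t)) constants ⟩
        f * 5000 * 5000 * (α * t * (α * t) * (t * t))              ≡⟨ ℕ-Ring.solve (f ∷ α ∷ t ∷ []) ⟩
        f * ((5000 * α * t) * (5000 * α * t) * (t * t))            ≤⟨ *-monoʳ-≤ f (*-mono₃-≤ 5000αt≤E 5000αt≤E t²≤4E) ⟩
        f * (E * E * (4 * E))                                      ≡⟨ ℕ-Ring.solve (f ∷ E ∷ []) ⟩
        4 * (f * (E * E * E))                                      ∎)

      U⁴-bound : ∀ c f → 4 * c * (8 * 8 * (8 * 8)) ≤ f * (5000 * 5000) * (5000 * 5000) →
                 c * (U * U * (U * U)) ≤ f * (t * t * (E * E * (E * E) * E))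
      U⁴-bound c f constants = *-cancelˡ-≤ 4 (begin
        4 * (c * (U * U * (U * U)))
          ≤⟨ *-monoʳ-≤ 4 (*-monoʳ-≤ c (*-mono-≤ (*-mono-≤ U≤8αt² U≤8αt²) (*-mono-≤ U≤8αt² U≤8αt²))) ⟩
        4 * (c * ((8 * α * (t * t)) * (8 * α * (t * t)) * ((8 * α * (t * t)) * (8 * α * (t * t)))))
          ≡⟨ ℕ-Ring.solve (c ∷ α ∷ t ∷ []) ⟩
        4 * c * (8 * 8 * (8 * 8)) * (α * t * (α * t) * (t * t) * (α * t * (α * t) * (t * t)))
          ≤⟨ *-monoˡ-≤ (α * t * (α * t) * (t * t) * (α * t * (α * t) * (t * t))) constants ⟩
        f * (5000 * 5000) * (5000 * 5000) * (α * t * (α * t) * (t * t) * (α * t * (α * t) * (t * t)))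
          ≡⟨ ℕ-Ring.solve (f ∷ α ∷ t ∷ []) ⟩
        f * (t * t * ((5000 * α * t) * (5000 * α * t) * ((5000 * α * t) * (5000 * α * t)) * (t * t)))
          ≤⟨ *-monoʳ-≤ f (*-monoʳ-≤ (t * t) (*-mono₃-≤ (*-mono-≤ 5000αt≤E 5000αt≤E) (*-mono-≤ 5000αt≤E 5000αt≤E) t²≤4E)) ⟩
        f * (t * t * (E * E * (E * E) * (4 * E)))
          ≡⟨ ℕ-Ring.solve (f ∷ t ∷ E ∷ []) ⟩
        4 * (f * (t * t * (E * E * (E * E) * E))) ∎)

    secondMoment-lower : ∀ {m p₂} → m ≤ 4 * α * t →
      t²E³ ≤ 12 * p₂ + (t * t * E + 3 * m * ((t * E + U) * (t * E + U))) → 39 * t²E³ ≤ 480 * p₂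
    secondMoment-lower {m} {p₂} m≤4αt t²E³≤ = +-cancelʳ-≤ t²E³ (39 * t²E³) (480 * p₂) (begin
      39 * t²E³ + t²E³      ≡⟨ +-comm (39 * t²E³) t²E³ ⟩
      40 * t²E³             ≤⟨ *-monoʳ-≤ 40 t²E³≤ ⟩
      40 * (12 * p₂ + D)    ≡⟨ trans (*-distribˡ-+ 40 (12 * p₂) D) (cong (_+ 40 * D) (sym (*-assoc 40 12 p₂))) ⟩
      480 * p₂ + 40 * D     ≤⟨ +-monoʳ-≤ (480 * p₂) 40D≤t²E³ ⟩
      480 * p₂ + t²E³       ∎)
      where
      q = t * E * (t * E)
      D = t * t * E + 3 * m * ((t * E + U) * (t * E + U))
      40D≤t²E³ : 40 * D ≤ t²E³
      40D≤t²E³ = *-cancelˡ-≤ 2 (begin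
        2 * (40 * D)
          ≤⟨ *-monoʳ-≤ 2 (*-monoʳ-≤ 40 (+-monoʳ-≤ (t * t * E) (*-mono-≤ (*-monoʳ-≤ 3 m≤4αt)
                                          (*-mono-≤ (+-monoʳ-≤ (t * E) U≤tE) (+-monoʳ-≤ (t * E) U≤tE))))) ⟩
        2 * (40 * (t * t * E + 3 * (4 * α * t) * ((t * E + t * E) * (t * E + t * E))))
          ≡⟨ expand t E α ⟩
        80 * (t * t * E) + 3840 * α * t * q
          ≤⟨ +-mono-≤ (*-monoʳ-≤ 80 (m≤m*n (t * t * E) E ⦃ >-nonZero 1≤E ⦄))
                      (*-monoˡ-≤ q (≤-trans (*-monoˡ-≤ t (*-monoˡ-≤ α (≤ᵇ⇒≤ 3840 5000 _))) 5000αt≤E)) ⟩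
        80 * (t * t * E * E) + E * q
          ≤⟨ +-monoˡ-≤ (E * q) (*-monoˡ-≤ (t * t * E * E) (≤-trans (≤ᵇ⇒≤ 80 5000 _) 5000≤E)) ⟩
        E * (t * t * E * E) + E * q
          ≡⟨ twice t E ⟩
        2 * t²E³ ∎)
        where
        expand : ∀ t E α → 2 * (40 * (t * t * E + 3 * (4 * α * t) * ((t * E + t * E) * (t * E + t * E))))
                           ≡ 80 * (t * t * E) + 3840 * α * t * (t * E * (t * E))
        expand = ℕ-Ring.solve-∀
        twice : ∀ t E → E * (t * t * E * E) + E * (t * E * (t * E)) ≡ 2 * (t * t * (E * E * E))
        twice = ℕ-Ring.solve-∀

    R₄ : ℕ
    R₄ = 3 * (t * t * (t * t)) * (E * E * (E * E) * E) + 30 * (t * t) * (U * U) * (E * E * E) + 15 * E * (U * U * (U * U))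

    fourthMoment-upper : t * t ≤ 2 * E + t → 240 * (t * t) * R₄ < 39 * 39 * (t²E³ * t²E³)
    fourthMoment-upper t²≤2E+t = begin-strict
      240 * (t * t) * R₄
        ≡⟨ distribute t E U ⟩
      t * t * (t * t) * (E * E * (E * E) * E) * (720 * (t * t)) + t * t * (t * t) * (E * E * E) * (7200 * (U * U))
        + t * t * E * (3600 * (U * U * (U * U)))
        ≤⟨ +-mono-≤ (+-mono-≤ (*-monoʳ-≤ (t * t * (t * t) * (E * E * (E * E) * E)) 720t²≤1466E)
                              (*-monoʳ-≤ (t * t * (t * t) * (E * E * E)) (U²-bound 7200 27 (≤ᵇ⇒≤ (4 * 7200 * (8 * 8)) (27 * 5000 * 5000) _))))
                    (*-monoʳ-≤ (t * t * E) (U⁴-bound 3600 27 (≤ᵇ⇒≤ (4 * 3600 * (8 * 8 * (8 * 8))) (27 * (5000 * 5000) * (5000 * 5000)) _))) ⟩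
      t * t * (t * t) * (E * E * (E * E) * E) * (1466 * E) + t * t * (t * t) * (E * E * E) * (27 * (E * E * E))
        + t * t * E * (27 * (t * t * (E * E * (E * E) * E)))
        ≡⟨ collect t E ⟩
      1520 * (t²E³ * t²E³)
        <⟨ *-monoˡ-< (t²E³ * t²E³) ⦃ >-nonZero (*-mono-≤ 0<t²E³ 0<t²E³) ⦄ (n<1+n 1520) ⟩
      39 * 39 * (t²E³ * t²E³) ∎
      where
      distribute : ∀ t E U → 240 * (t * t) * (3 * (t * t * (t * t)) * (E * E * (E * E) * E) + 30 * (t * t) * (U * U) * (E * E * E) + 15 * E * (U * U * (U * U)))
        ≡ t * t * (t * t) * (E * E * (E * E) * E) * (720 * (t * t)) + t * t * (t * t) * (E * E * E) * (7200 * (U * U))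
          + t * t * E * (3600 * (U * U * (U * U)))
      distribute = ℕ-Ring.solve-∀
      collect : ∀ t E → t * t * (t * t) * (E * E * (E * E) * E) * (1466 * E) + t * t * (t * t) * (E * E * E) * (27 * (E * E * E))
        + t * t * E * (27 * (t * t * (E * E * (E * E) * E))) ≡ 1520 * (t * t * (E * E * E) * (t * t * (E * E * E)))
      collect = ℕ-Ring.solve-∀
      720t²≤1466E : 720 * (t * t) ≤ 1466 * E
      720t²≤1466E = begin
        720 * (t * t)        ≤⟨ *-monoʳ-≤ 720 t²≤2E+t ⟩
        720 * (2 * E + t)    ≡⟨ ℕ-Ring.solve (E ∷ t ∷ []) ⟩
        1440 * E + 720 * t   ≤⟨ +-monoʳ-≤ (1440 * E) (≤-trans (*-monoˡ-≤ t (≤ᵇ⇒≤ 720 (26 * 5000) _))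
                                                      (≤-trans (≤-reflexive (*-assoc 26 5000 t)) (*-monoʳ-≤ 26 5000t≤E))) ⟩
        1440 * E + 26 * E    ≡⟨ ℕ-Ring.solve (E ∷ []) ⟩
        1466 * E             ∎

    -- Through 4 p₂² ≤ t² p₄ ≤ t² y₄, the lower bound on p₂ exceeds what the fourth moment y₄ of the interval allows.
    moment-contradiction : ∀ {m p₂ p₄ y₄} → t * t ≤ 2 * E + t → m ≤ 4 * α * t →
      t²E³ ≤ 12 * p₂ + (t * t * E + 3 * m * ((t * E + U) * (t * E + U))) →
      4 * (p₂ * p₂) ≤ t * t * p₄ → p₄ ≤ y₄ → 240 * y₄ ≤ R₄ → ⊥
    moment-contradiction {m} {p₂} {p₄} {y₄} t²≤2E+t m≤4αt t²E³≤ 4p₂²≤t²p₄ p₄≤y₄ 240y₄≤R₄ = <-irrefl refl (begin-strict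
      39 * 39 * (t²E³ * t²E³)       ≡⟨ square 39 t²E³ ⟩
      (39 * t²E³) * (39 * t²E³)     ≤⟨ *-mono-≤ 39t²E³≤480p₂ 39t²E³≤480p₂ ⟩
      (480 * p₂) * (480 * p₂)       ≡⟨ scale p₂ ⟩
      57600 * (4 * (p₂ * p₂))       ≤⟨ *-monoʳ-≤ 57600 (≤-trans 4p₂²≤t²p₄ (*-monoʳ-≤ (t * t) p₄≤y₄)) ⟩
      57600 * (t * t * y₄)          ≡⟨ regroup t y₄ ⟩
      240 * (t * t) * (240 * y₄)    ≤⟨ *-monoʳ-≤ (240 * (t * t)) 240y₄≤R₄ ⟩
      240 * (t * t) * R₄            <⟨ fourthMoment-upper t²≤2E+t ⟩
      39 * 39 * (t²E³ * t²E³)       ∎)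
      where
      39t²E³≤480p₂ : 39 * t²E³ ≤ 480 * p₂
      39t²E³≤480p₂ = secondMoment-lower {m} {p₂} m≤4αt t²E³≤
      square : ∀ c x → c * c * (x * x) ≡ (c * x) * (c * x)
      square = ℕ-Ring.solve-∀
      scale : ∀ p → (480 * p) * (480 * p) ≡ 57600 * (4 * (p * p))
      scale = ℕ-Ring.solve-∀
      regroup : ∀ t y → 57600 * (t * t * y) ≡ 240 * (t * t) * (240 * y)
      regroup = ℕ-Ring.solve-∀

  module LabelCounts {t N m E : ℕ} (pairs-count : 2 * N + t ≡ t * t) (E≡N+m : E ≡ N + m) where

    m≤4αt : ∀ α → 2 * E + t ≤ t * t + 8 * α * t → m ≤ 4 * α * t
    m≤4αt α 2E+t≤ = *-cancelˡ-≤ 2 (+-cancelˡ-≤ (t * t) _ _ (begin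
      t * t + 2 * m            ≡⟨ cong (_+ 2 * m) (sym pairs-count) ⟩
      2 * N + t + 2 * m        ≡⟨ ℕ-Ring.solve (N ∷ t ∷ m ∷ []) ⟩
      2 * (N + m) + t          ≡⟨ cong (λ e → 2 * e + t) (sym E≡N+m) ⟩
      2 * E + t                ≤⟨ 2E+t≤ ⟩
      t * t + 8 * α * t        ≡⟨ cong (t * t +_) (ℕ-Ring.solve (α ∷ t ∷ [])) ⟩
      t * t + 2 * (4 * α * t)  ∎))

    N≤E : N ≤ E
    N≤E = ≤-trans (m≤m+n N m) (≤-reflexive (sym E≡N+m))

    t²≤2E+t : t * t ≤ 2 * E + t
    t²≤2E+t = ≤-trans (≤-reflexive (sym pairs-count)) (+-monoˡ-≤ t (*-monoʳ-≤ 2 N≤E))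

    t≤N : 3 ≤ t → t ≤ N
    t≤N 3≤t = *-cancelˡ-≤ 2 (+-cancelʳ-≤ t (2 * t) (2 * N) (begin
      2 * t + t    ≡⟨ ℕ-Ring.solve (t ∷ []) ⟩
      3 * t        ≤⟨ *-monoˡ-≤ t 3≤t ⟩
      t * t        ≡⟨ sym pairs-count ⟩
      2 * N + t    ∎))

    t²≤4E : 3 ≤ t → t * t ≤ 4 * E
    t²≤4E 3≤t = begin
      t * t        ≡⟨ sym pairs-count ⟩
      2 * N + t    ≤⟨ +-mono-≤ (*-monoʳ-≤ 2 N≤E) (≤-trans (t≤N 3≤t) N≤E) ⟩
      2 * E + E    ≤⟨ +-monoʳ-≤ (2 * E) (m≤m+n E (E + 0)) ⟩
      2 * E + 2 * E ≡⟨ ℕ-Ring.solve (E ∷ []) ⟩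
      4 * E        ∎

    4αt≤N : ∀ α → 8 * α + 1 ≤ t → 4 * α * t ≤ N
    4αt≤N α 8α+1≤t = *-cancelˡ-≤ 2 (+-cancelʳ-≤ t (2 * (4 * α * t)) (2 * N) (begin
      2 * (4 * α * t) + t  ≡⟨ ℕ-Ring.solve (α ∷ t ∷ []) ⟩
      (8 * α + 1) * t      ≤⟨ *-monoˡ-≤ t 8α+1≤t ⟩
      t * t                ≡⟨ sym pairs-count ⟩
      2 * N + t            ∎))

    u≤2mt : ∀ {u} → N * u ≤ m * (t * (E ∸ 1)) → m ≤ N → 1 ≤ N → u ≤ 2 * m * t
    u≤2mt {u} Nu≤ m≤N 1≤N = *-cancelˡ-≤ N ⦃ >-nonZero 1≤N ⦄ (begin
      N * u                ≤⟨ Nu≤ ⟩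
      m * (t * (E ∸ 1))    ≤⟨ *-monoʳ-≤ m (*-monoʳ-≤ t (m∸n≤m E 1)) ⟩
      m * (t * E)          ≡⟨ cong (λ e → m * (t * e)) E≡N+m ⟩
      m * (t * (N + m))    ≤⟨ *-monoʳ-≤ m (*-monoʳ-≤ t (+-monoʳ-≤ N m≤N)) ⟩
      m * (t * (N + N))    ≡⟨ ℕ-Ring.solve (m ∷ t ∷ N ∷ []) ⟩
      N * (2 * m * t)      ∎)

  -- x ↦ x² − x is monotone, stated without subtraction
  square-gap-mono : ∀ {n d} → n ≤ d → n * n + d ≤ d * d + n
  square-gap-mono {n} {d} n≤d = subst (λ d → n * n + d ≤ d * d + n) (m+[n∸m]≡n n≤d) (grow n (d ∸ n))
    where
    grow : ∀ n e → n * n + (n + e) ≤ (n + e) * (n + e) + n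
    grow n e = begin
      n * n + (n + e)              ≡⟨ ℕ-Ring.solve (n ∷ e ∷ []) ⟩
      n * n + n + e                ≤⟨ +-monoʳ-≤ (n * n + n) (≤-trans (m≤m*m e) (m≤m+n (e * e) (2 * n * e))) ⟩
      n * n + n + (e * e + 2 * n * e) ≡⟨ ℕ-Ring.solve (n ∷ e ∷ []) ⟩
      (n + e) * (n + e) + n        ∎
      where
      m≤m*m : ∀ e → e ≤ e * e
      m≤m*m zero    = z≤n
      m≤m*m (suc e) = m≤m*n (suc e) (suc e)

  edge-budget : ∀ {E n t α} → 2 * E + n ≤ n * n → n ≤ t + 2 * α → α ≤ t → 2 * E + t ≤ t * t + 8 * α * t
  edge-budget {E} {n} {t} {α} 2E+n≤n² n≤d α≤t = begin
    2 * E + t                     ≤⟨ +-monoʳ-≤ (2 * E) (m≤m+n t (2 * α)) ⟩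
    2 * E + d                     ≤⟨ +-cancelʳ-≤ n (2 * E + d) (d * d) (begin
                                       2 * E + d + n   ≡⟨ +-comm-right (2 * E) d n ⟩
                                       2 * E + n + d   ≤⟨ +-monoˡ-≤ d 2E+n≤n² ⟩
                                       n * n + d       ≤⟨ square-gap-mono n≤d ⟩
                                       d * d + n       ∎) ⟩
    d * d                         ≡⟨ square t α ⟩
    t * t + 4 * α * t + 4 * α * α ≤⟨ +-monoʳ-≤ (t * t + 4 * α * t) (*-monoʳ-≤ (4 * α) α≤t) ⟩
    t * t + 4 * α * t + 4 * α * t ≡⟨ ℕ-Ring.solve (t ∷ α ∷ []) ⟩
    t * t + 8 * α * t             ∎
    where
    d = t + 2 * α
    +-comm-right : ∀ x y z → x + y + z ≡ x + z + y
    +-comm-right = ℕ-Ring.solve-∀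
    square : ∀ t α → (t + 2 * α) * (t + 2 * α) ≡ t * t + 4 * α * t + 4 * α * α
    square = ℕ-Ring.solve-∀

module MagicClique where

  open import Data.Nat as ℕ using (ℕ)
  import Data.Nat.Properties as ℕ
  import Data.Nat.Tactic.RingSolver as ℕ-Ring
  open import Data.Integer as ℤ using (ℤ; +_; _+_; _*_; _-_; -_; ∣_∣; _≤_)
  import Data.Integer.Properties as ℤ
  open import Data.Integer.Tactic.RingSolver using (solve-∀)
  open import Data.List using (List; map; length)
  open import Data.List.Properties using (length-map)
  open import Data.List.Membership.Propositional using (_∈_)
  open import Data.List.Membership.Propositional.Properties using (∈-map⁻)
  open import Data.List.Relation.Unary.Unique.Propositional using (Unique)
  open import Data.Product using (_×_; _,_; proj₁; proj₂)
  open import Data.Empty using (⊥)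
  open import Relation.Binary.PropositionalEquality
  open ListSums
  open Integers
  open Lists
  open PairSums
  open IntervalSums
  open Estimates

  module _ {A : Set} (clique : List A) (g : A → ℕ) (ℓ : A × A → ℕ) (c : ℕ)
           (magic : ∀ {u v} → (u , v) ∈ pairs clique → g u ℕ.+ g v ℕ.+ ℓ (u , v) ≡ c)
           (a E : ℕ) (labels-unique : Unique (map ℓ (pairs clique)))
           (labels-in : ∀ {p} → p ∈ pairs clique → ℓ p ∈ interval a E) where

    t N : ℕ
    t = length clique
    N = length (pairs clique)

    T : ℤ
    T = + t

    private
      σ : ℤ
      σ = ∑ (λ x → + g x) clique

    centred : A → ℤ
    centred x = T * + g x - σ

    centred-sum : S₁ centred clique ≡ + 0
    centred-sum = ∑-centred (λ x → + g x) clique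

    shift : ℤ
    shift = T * + c - + 2 * σ

    w w² w⁴ : ℕ → ℤ
    w = affine T shift
    w² = affine² T shift
    w⁴ = affine⁴ T shift

    w-label : ∀ {u v} → (u , v) ∈ pairs clique → w (ℓ (u , v)) ≡ - (centred u + centred v)
    w-label {u} {v} uv∈ = trans (cong (λ s → T * + ℓ (u , v) - (T * + s - + 2 * σ)) (sym (magic uv∈)))
                                (ring T σ (+ g u) (+ g v) (+ ℓ (u , v)))
      where ring : ∀ T σ x y z → T * z - (T * (x + y + z) - + 2 * σ) ≡ - ((T * x - σ) + (T * y - σ))
            ring = solve-∀

    labels : List ℕ
    labels = map ℓ (pairs clique)

    ∑-labels : ∀ (h : ℤ → ℤ) (F : ℤ → ℤ → ℤ) → (∀ x y → h (- (x + y)) ≡ F x y) →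
               ∑ (λ z → h (w z)) labels ≡ pairSum centred F clique
    ∑-labels h F hF = trans (∑-map (λ z → h (w z)) ℓ (pairs clique))
                            (∑-cong (pairs clique) (λ {p} p∈ → trans (cong h (w-label p∈)) (hF (centred (proj₁ p)) (centred (proj₂ p)))))

    ∑w-labels : ∑ w labels ≡ + 0
    ∑w-labels = begin
      ∑ w labels                  ≡⟨ sym (ℤ.neg-involutive _) ⟩
      - (- ∑ w labels)            ≡⟨ cong -_ (sym (∑-neg w labels)) ⟩
      - ∑ (λ z → - w z) labels    ≡⟨ cong -_ (∑-labels -_ sum¹ (λ x y → ℤ.neg-involutive (x + y))) ⟩
      - pairSum centred sum¹ clique ≡⟨ cong -_ (pairSum-sum¹-centred centred clique centred-sum) ⟩
      + 0                         ∎
      where open ≡-Reasoning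

    P₂ P₄ : ℤ
    P₂ = ∑ w² labels
    P₄ = ∑ w⁴ labels

    labelMoment-inequality : 8 ℕ.≤ t → + 4 * (P₂ * P₂) ≤ T * T * P₄
    labelMoment-inequality 8≤t = subst₂ (λ p₂ p₄ → + 4 * (p₂ * p₂) ≤ T * T * p₄) (sym P₂≡) (sym P₄≡)
                          (pairMoment-inequality centred clique centred-sum 8≤t)
      where
      P₂≡ : P₂ ≡ pairSum centred sum² clique
      P₂≡ = ∑-labels (λ y → y * y) sum² (λ x y → neg-square (x + y))
        where neg-square : ∀ s → - s * - s ≡ s * s
              neg-square = solve-∀
      P₄≡ : P₄ ≡ pairSum centred sum⁴ clique
      P₄≡ = ∑-labels (λ y → y * y * (y * y)) sum⁴ (λ x y → neg-fourth (x + y))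
        where neg-fourth : ∀ s → - s * - s * (- s * - s) ≡ s * s * (s * s)
              neg-fourth = solve-∀

    labels⊆interval : ∀ {z} → z ∈ labels → z ∈ interval a E
    labels⊆interval z∈ with ∈-map⁻ ℓ z∈
    ... | p , p∈ , refl = labels-in p∈

    open Complement (complement labels-unique labels⊆interval)

    m : ℕ
    m = length rest

    E≡N+m : E ≡ N ℕ.+ m
    E≡N+m = trans (sym (length-interval a E)) (trans length-split (cong (ℕ._+ m) (length-map ℓ (pairs clique))))

    U : ℤ
    U = endSum T shift a E

    R : ℕ
    R = t ℕ.* (E ℕ.∸ 1)

    spread-bound : ∀ {z} → z ∈ rest → ∣ + 2 * w z - U ∣ ℕ.≤ R
    spread-bound z∈ = ∣twice-affine-endSum∣≤ T shift a E (rest⊆ z∈)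

    -- The labels have w-sum 0, so the rest carries the whole interval sum E·U/2.
    ∑-spread : ∑ (λ z → + 2 * w z - U) rest ≡ + N * U
    ∑-spread = begin
      ∑ (λ z → + 2 * w z - U) rest         ≡⟨ ∑-affine (+ 2) U w rest ⟩
      + 2 * ∑ w rest - + m * U             ≡⟨ cong (λ s → + 2 * s - + m * U) ∑w-rest ⟩
      + 2 * ∑ w (interval a E) - + m * U   ≡⟨ cong (_- + m * U) (∑affine-interval T shift a E) ⟩
      + E * U - + m * U                    ≡⟨ cong (λ e → + e * U - + m * U) E≡N+m ⟩
      + (N ℕ.+ m) * U - + m * U            ≡⟨ ring (+ N) (+ m) U ⟩
      + N * U                              ∎
      where
      open ≡-Reasoning
      ∑w-rest : ∑ w rest ≡ ∑ w (interval a E)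
      ∑w-rest = sym (trans (∑-split w) (trans (cong (_+ ∑ w rest) ∑w-labels) (ℤ.+-identityˡ _)))
      ring : ∀ n m u → (n + m) * u - m * u ≡ n * u
      ring = solve-∀

    N∣U∣≤mR : N ℕ.* ∣ U ∣ ℕ.≤ m ℕ.* R
    N∣U∣≤mR = subst (ℕ._≤ m ℕ.* R) (trans (cong ∣_∣ ∑-spread) (ℤ.abs-* (+ N) U))
                    (∣∑∣≤length* (λ z → + 2 * w z - U) R rest spread-bound)

    4∑w²-rest≤ : 4 ℕ.* ∣ ∑ w² rest ∣ ℕ.≤ m ℕ.* ((∣ U ∣ ℕ.+ R) ℕ.* (∣ U ∣ ℕ.+ R))
    4∑w²-rest≤ = ⟦⟧ℤ-≤⇒⟦⟧ℕ-≤ (‵ 4 ‵* ‵ ∣ ∑ w² rest ∣) (‵ m ‵* ‵ B)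
      (subst (λ s → + 4 * s ≤ + m * + B) (sym (ℤ.0≤i⇒+∣i∣≡i (∑-nonneg w² rest (λ {z} _ → square-nonneg (w z)))))
        (subst (_≤ + m * + B) (∑-*ˡ (+ 4) w² rest) (∑-≤-length* (λ z → + 4 * w² z) (+ B) rest 4w²≤B)))
      where
      B = (∣ U ∣ ℕ.+ R) ℕ.* (∣ U ∣ ℕ.+ R)
      4w²≤B : ∀ {z} → z ∈ rest → + 4 * w² z ≤ + B
      4w²≤B {z} z∈ = subst (_≤ + B) (sym (trans (double (w z)) (trans (square-∣∣ (+ 2 * w z)) (sym (ℤ.pos-* ∣ + 2 * w z ∣ ∣ + 2 * w z ∣)))))
                           (ℤ.+≤+ (ℕ.*-mono-≤ ∣2w∣≤ ∣2w∣≤))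
        where
        double : ∀ x → + 4 * (x * x) ≡ (+ 2 * x) * (+ 2 * x)
        double = solve-∀
        ∣2w∣≤ : ∣ + 2 * w z ∣ ℕ.≤ ∣ U ∣ ℕ.+ R
        ∣2w∣≤ = subst (λ s → ∣ s ∣ ℕ.≤ ∣ U ∣ ℕ.+ R) (ring U (+ 2 * w z))
                      (ℕ.≤-trans (ℤ.∣i+j∣≤∣i∣+∣j∣ U _) (ℕ.+-monoʳ-≤ ∣ U ∣ (spread-bound z∈)))
          where ring : ∀ u x → u + (x - u) ≡ x
                ring = solve-∀

    private
      P₂-nonneg : + 0 ≤ P₂
      P₂-nonneg = ∑-nonneg w² labels (λ {z} _ → square-nonneg (w z))

      P₄-nonneg : + 0 ≤ P₄
      P₄-nonneg = ∑-nonneg w⁴ labels (λ {z} _ → square-nonneg (w² z))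

      +∣P₂∣≡P₂ : + ∣ P₂ ∣ ≡ P₂
      +∣P₂∣≡P₂ = ℤ.0≤i⇒+∣i∣≡i P₂-nonneg

      +∣P₄∣≡P₄ : + ∣ P₄ ∣ ≡ P₄
      +∣P₄∣≡P₄ = ℤ.0≤i⇒+∣i∣≡i P₄-nonneg

    labelMoment-inequalityℕ : 8 ℕ.≤ t → 4 ℕ.* (∣ P₂ ∣ ℕ.* ∣ P₂ ∣) ℕ.≤ t ℕ.* t ℕ.* ∣ P₄ ∣
    labelMoment-inequalityℕ 8≤t = ⟦⟧ℤ-≤⇒⟦⟧ℕ-≤ (‵ 4 ‵* (‵ ∣ P₂ ∣ ‵* ‵ ∣ P₂ ∣)) (‵ t ‵* ‵ t ‵* ‵ ∣ P₄ ∣)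
      (subst₂ (λ p₂ p₄ → + 4 * (p₂ * p₂) ≤ T * T * p₄) (sym +∣P₂∣≡P₂) (sym +∣P₄∣≡P₄) (labelMoment-inequality 8≤t))

    ∣P₄∣≤∣∑w⁴-interval∣ : ∣ P₄ ∣ ℕ.≤ ∣ ∑ w⁴ (interval a E) ∣
    ∣P₄∣≤∣∑w⁴-interval∣ = ℤ.drop‿+≤+ (subst₂ _≤_ (sym +∣P₄∣≡P₄) (sym (ℤ.0≤i⇒+∣i∣≡i (ℤ.≤-trans P₄-nonneg P₄≤Y₄))) P₄≤Y₄)
      where
      P₄≤Y₄ : P₄ ≤ ∑ w⁴ (interval a E)
      P₄≤Y₄ = subst (P₄ ≤_) (sym (∑-split w⁴)) (≤-+-nonneg P₄ (∑-nonneg w⁴ rest (λ {z} _ → square-nonneg (w² z))))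

    ∣∑w²-interval∣≡∣P₂∣+∣∑w²-rest∣ : ∣ ∑ w² (interval a E) ∣ ≡ ∣ P₂ ∣ ℕ.+ ∣ ∑ w² rest ∣
    ∣∑w²-interval∣≡∣P₂∣+∣∑w²-rest∣ = ℤ.+-injective (begin
      + ∣ ∑ w² (interval a E) ∣         ≡⟨ ℤ.0≤i⇒+∣i∣≡i (∑-nonneg w² (interval a E) (λ {z} _ → square-nonneg (w z))) ⟩
      ∑ w² (interval a E)               ≡⟨ ∑-split w² ⟩
      P₂ + ∑ w² rest                    ≡⟨ cong₂ _+_ (sym +∣P₂∣≡P₂) (sym (ℤ.0≤i⇒+∣i∣≡i (∑-nonneg w² rest (λ {z} _ → square-nonneg (w z))))) ⟩
      + ∣ P₂ ∣ + + ∣ ∑ w² rest ∣         ∎)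
      where open ≡-Reasoning

    secondMoment-bound : 2 ℕ.≤ E → R ℕ.≤ t ℕ.* E →
      t ℕ.* t ℕ.* (E ℕ.* E ℕ.* E) ℕ.≤
      12 ℕ.* ∣ P₂ ∣ ℕ.+ (t ℕ.* t ℕ.* E ℕ.+ 3 ℕ.* m ℕ.* ((t ℕ.* E ℕ.+ ∣ U ∣) ℕ.* (t ℕ.* E ℕ.+ ∣ U ∣)))
    secondMoment-bound 2≤E R≤tE = begin
      t ℕ.* t ℕ.* (E ℕ.* E ℕ.* E)             ≤⟨ ∑affine²-interval-≥ T shift a E 2≤E ⟩
      12 ℕ.* y₂ ℕ.+ t ℕ.* t ℕ.* E             ≡⟨ cong (λ y → 12 ℕ.* y ℕ.+ t ℕ.* t ℕ.* E) y₂≡p₂+z₂ ⟩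
      12 ℕ.* (p₂ ℕ.+ z₂) ℕ.+ t ℕ.* t ℕ.* E    ≡⟨ ring p₂ z₂ (t ℕ.* t ℕ.* E) ⟩
      12 ℕ.* p₂ ℕ.+ (t ℕ.* t ℕ.* E ℕ.+ 3 ℕ.* (4 ℕ.* z₂))
        ≤⟨ ℕ.+-monoʳ-≤ (12 ℕ.* p₂) (ℕ.+-monoʳ-≤ (t ℕ.* t ℕ.* E)
             (ℕ.*-monoʳ-≤ 3 (ℕ.≤-trans 4∑w²-rest≤ (ℕ.*-monoʳ-≤ m (ℕ.*-mono-≤ u+R≤ u+R≤))))) ⟩
      12 ℕ.* p₂ ℕ.+ (t ℕ.* t ℕ.* E ℕ.+ 3 ℕ.* (m ℕ.* ((t ℕ.* E ℕ.+ ∣ U ∣) ℕ.* (t ℕ.* E ℕ.+ ∣ U ∣))))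
        ≡⟨ cong (λ s → 12 ℕ.* p₂ ℕ.+ (t ℕ.* t ℕ.* E ℕ.+ s)) (sym (ℕ.*-assoc 3 m _)) ⟩
      12 ℕ.* p₂ ℕ.+ (t ℕ.* t ℕ.* E ℕ.+ 3 ℕ.* m ℕ.* ((t ℕ.* E ℕ.+ ∣ U ∣) ℕ.* (t ℕ.* E ℕ.+ ∣ U ∣))) ∎
      where
      open ℕ.≤-Reasoning
      p₂ = ∣ P₂ ∣
      y₂ = ∣ ∑ w² (interval a E) ∣
      z₂ = ∣ ∑ w² rest ∣
      y₂≡p₂+z₂ = ∣∑w²-interval∣≡∣P₂∣+∣∑w²-rest∣
      u+R≤ : ∣ U ∣ ℕ.+ R ℕ.≤ t ℕ.* E ℕ.+ ∣ U ∣
      u+R≤ = ℕ.≤-trans (ℕ.≤-reflexive (ℕ.+-comm ∣ U ∣ R)) (ℕ.+-monoˡ-≤ ∣ U ∣ R≤tE)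
      ring : ∀ p z x → 12 ℕ.* (p ℕ.+ z) ℕ.+ x ≡ 12 ℕ.* p ℕ.+ (x ℕ.+ 3 ℕ.* (4 ℕ.* z))
      ring = ℕ-Ring.solve-∀

    no-magic-clique : ∀ {α} → 1 ℕ.≤ α → 20000 ℕ.* α ℕ.≤ t → 2 ℕ.* E ℕ.+ t ℕ.≤ t ℕ.* t ℕ.+ 8 ℕ.* α ℕ.* t → ⊥
    no-magic-clique {α} 1≤α 20000α≤t 2E+t≤ =
      moment-contradiction {α} {t} {E} {∣ U ∣} 1≤α 20000α≤t (t²≤4E 3≤t) ∣U∣≤8αt²
        {m} {∣ P₂ ∣} {∣ P₄ ∣} {∣ ∑ w⁴ (interval a E) ∣} t²≤2E+t rest-small (secondMoment-bound 2≤E R≤tE)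
        (labelMoment-inequalityℕ 8≤t) ∣P₄∣≤∣∑w⁴-interval∣
        (∑affine⁴-interval-≤ T shift a E 2≤E)
      where
      open ℕ.≤-Reasoning
      open LabelCounts {t} {N} {m} {E} (length-pairs clique) E≡N+m
      9α≤t : 9 ℕ.* α ℕ.≤ t
      9α≤t = ℕ.≤-trans (ℕ.*-monoˡ-≤ α (ℕ.≤ᵇ⇒≤ 9 20000 _)) 20000α≤t
      8α+1≤t : 8 ℕ.* α ℕ.+ 1 ℕ.≤ t
      8α+1≤t = ℕ.≤-trans (ℕ.+-monoʳ-≤ (8 ℕ.* α) 1≤α) (ℕ.≤-trans (ℕ.≤-reflexive (ℕ.+-comm (8 ℕ.* α) α)) 9α≤t)
      8≤t : 8 ℕ.≤ t
      8≤t = ℕ.≤-trans (ℕ.≤-trans (ℕ.*-monoʳ-≤ 8 1≤α) (ℕ.m≤m+n (8 ℕ.* α) 1)) 8α+1≤t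
      3≤t : 3 ℕ.≤ t
      3≤t = ℕ.≤-trans (ℕ.≤ᵇ⇒≤ 3 8 _) 8≤t
      t≤E : t ℕ.≤ E
      t≤E = ℕ.≤-trans (t≤N 3≤t) N≤E
      2≤E : 2 ℕ.≤ E
      2≤E = ℕ.≤-trans (ℕ.≤ᵇ⇒≤ 2 3 _) (ℕ.≤-trans 3≤t t≤E)
      R≤tE : R ℕ.≤ t ℕ.* E
      R≤tE = ℕ.*-monoʳ-≤ t (ℕ.m∸n≤m E 1)
      rest-small : m ℕ.≤ 4 ℕ.* α ℕ.* t
      rest-small = m≤4αt α 2E+t≤
      ∣U∣≤8αt² : ∣ U ∣ ℕ.≤ 8 ℕ.* α ℕ.* (t ℕ.* t)
      ∣U∣≤8αt² = begin
        ∣ U ∣                     ≤⟨ u≤2mt N∣U∣≤mR (ℕ.≤-trans rest-small (4αt≤N α 8α+1≤t))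
                                          (ℕ.≤-trans (ℕ.≤ᵇ⇒≤ 1 3 _) (ℕ.≤-trans 3≤t (t≤N 3≤t))) ⟩
        2 ℕ.* m ℕ.* t             ≤⟨ ℕ.*-monoˡ-≤ t (ℕ.*-monoʳ-≤ 2 rest-small) ⟩
        2 ℕ.* (4 ℕ.* α ℕ.* t) ℕ.* t ≡⟨ regroup α t ⟩
        8 ℕ.* α ℕ.* (t ℕ.* t)     ∎
        where regroup : ∀ α t → 2 ℕ.* (4 ℕ.* α ℕ.* t) ℕ.* t ≡ 8 ℕ.* α ℕ.* (t ℕ.* t)
              regroup = ℕ-Ring.solve-∀

module FullClique where

  open import Defs hiding (sym)
  open import Data.Nat as ℕ using (ℕ; suc)
  import Data.Nat.Properties as ℕ
  open import Data.Nat.ListAction using (sum)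
  open import Data.Bool using (Bool; true; false; _∧_; if_then_else_; T)
  import Data.Bool as Bool
  import Data.Bool.Properties as Bool
  open import Data.Fin as Fin using (Fin; toℕ; _↑ˡ_; splitAt)
  import Data.Fin.Properties as Fin
  open import Data.List using (List; []; _∷_; map; length; allFin; concatMap; filter; filterᵇ)
  open import Data.List.Properties using (length-map; length-++; length-tabulate; map-cong)
  open import Data.List.Membership.Propositional using (_∈_)
  open import Data.List.Membership.Propositional.Properties using (∈-map⁺; ∈-allFin; ∈-filter⁺; ∈-filter⁻; ∈-concatMap⁺)
  open import Data.List.Relation.Unary.Any as Any using (here; there)
  open import Data.List.Relation.Unary.AllPairs using (AllPairs)
  import Data.List.Relation.Unary.AllPairs.Properties as AllPairs
  open import Data.List.Relation.Unary.Unique.Propositional using (Unique)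
  import Data.List.Relation.Unary.Unique.Propositional.Properties as Unique
  open import Data.Product using (Σ-syntax; _×_; _,_; proj₁; proj₂)
  open import Data.Sum using (_⊎_; inj₁; inj₂)
  open import Data.Sum.Properties using (inj₂-injective)
  open import Data.Empty using (⊥-elim)
  open import Function using (_∘_)
  open import Relation.Nullary using (Dec; yes; no; ¬?; _⊎-dec_)
  open import Relation.Nullary.Decidable using (T?)
  open import Relation.Unary using (Decidable)
  open import Relation.Binary.PropositionalEquality
  open import Relation.Binary.Definitions using (Tri; tri<; tri≈; tri>)
  open import Axiom.UniquenessOfIdentityProofs using (module Decidable⇒UIP)
  open Lists
  open IntervalSums using (interval; ∈-interval⁻; ∈-interval⁺; length-interval; interval⁺)

  private
    length-concatMap : ∀ {A B : Set} (f : A → List B) xs → length (concatMap f xs) ≡ sum (map (length ∘ f) xs)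
    length-concatMap f []       = refl
    length-concatMap f (x ∷ xs) = trans (length-++ (f x)) (cong (length (f x) ℕ.+_) (length-concatMap f xs))

    sum-indicator : ∀ {A : Set} (b : A → Bool) xs → sum (map (λ x → if b x then 1 else 0) xs) ≡ length (filterᵇ b xs)
    sum-indicator b []       = refl
    sum-indicator b (x ∷ xs) with b x
    ... | true  = cong suc (sum-indicator b xs)
    ... | false = sum-indicator b xs

    length-filter-partition : ∀ {A : Set} {P : A → Set} (P? : Decidable P) xs →
      length (filter P? xs) ℕ.+ length (filter (¬? ∘ P?) xs) ≡ length xs
    length-filter-partition P? []       = refl
    length-filter-partition P? (x ∷ xs) with P? x
    ... | yes _ = cong suc (length-filter-partition P? xs)
    ... | no  _ = trans (ℕ.+-suc _ _) (cong suc (length-filter-partition P? xs))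

  adj-↑ˡ : ∀ {n} (G : Graph n) k (u v : Fin n) → adj (addIsolated G k) (u ↑ˡ k) (v ↑ˡ k) ≡ adj G u v
  adj-↑ˡ {n} G k u v rewrite Fin.splitAt-↑ˡ n u k | Fin.splitAt-↑ˡ n v k = refl

  adj-addIsolated⁻ : ∀ {n} (G : Graph n) k (x y : Fin (n ℕ.+ k)) → adj (addIsolated G k) x y ≡ true →
                     Σ[ u ∈ Fin n ] Σ[ v ∈ Fin n ] u ↑ˡ k ≡ x × v ↑ˡ k ≡ y
  adj-addIsolated⁻ {n} G k x y xy with splitAt n x in eqx | splitAt n y in eqy | xy
  ... | inj₁ u | inj₁ v | _  = u , v , Fin.splitAt⁻¹-↑ˡ eqx , Fin.splitAt⁻¹-↑ˡ eqy
  ... | inj₁ _ | inj₂ _ | ()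
  ... | inj₂ _ | inj₁ _ | ()
  ... | inj₂ _ | inj₂ _ | ()

  module _ {n : ℕ} (G : Graph n) where

    Full : Fin n → Set
    Full u = ∀ w → u ≡ w ⊎ adj G u w ≡ true

    full? : Decidable Full
    full? u = Fin.all? (λ w → (u Fin.≟ w) ⊎-dec (adj G u w Bool.≟ true))

    fullVertices : List (Fin n)
    fullVertices = filter full? (allFin n)

    nonAdjacent : Fin n → Fin n → Bool
    nonAdjacent i j = if adj G i j then false else true

    nonEdgesFrom : Fin n → List (Fin n × Fin n)
    nonEdgesFrom i = map (i ,_) (filterᵇ (λ j → (toℕ i ℕ.<ᵇ toℕ j) ∧ nonAdjacent i j) (allFin n))

    nonEdges : List (Fin n × Fin n)
    nonEdges = concatMap nonEdgesFrom (allFin n)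

    length-nonEdges : length nonEdges ≡ nonEdgeCount G
    length-nonEdges = trans (length-concatMap _ (allFin n)) (cong sum (map-cong row (allFin n)))
      where
      row : ∀ i → length (nonEdgesFrom i) ≡ sum (map (λ j → if (toℕ i ℕ.<ᵇ toℕ j) ∧ nonAdjacent i j then 1 else 0) (allFin n))
      row i = trans (length-map (i ,_) (filterᵇ (λ j → (toℕ i ℕ.<ᵇ toℕ j) ∧ nonAdjacent i j) (allFin n))) (sym (sum-indicator _ (allFin n)))

    ∈-nonEdges : ∀ {i j} → toℕ i ℕ.< toℕ j → adj G i j ≡ false → (i , j) ∈ nonEdges
    ∈-nonEdges {i} {j} i<j ¬ij =
      ∈-concatMap⁺ nonEdgesFrom (Any.map (λ { refl → ∈-map⁺ (i ,_) (∈-filter⁺ (T? ∘ row i) (∈-allFin j) row-ij) }) (∈-allFin i))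
      where
      row : Fin n → Fin n → Bool
      row i j = (toℕ i ℕ.<ᵇ toℕ j) ∧ nonAdjacent i j
      row-ij : T (row i j)
      row-ij rewrite ¬ij = subst T (sym (Bool.∧-identityʳ _)) (ℕ.<⇒<ᵇ i<j)

    ends : Fin n × Fin n → List (Fin n)
    ends e = proj₁ e ∷ proj₂ e ∷ []

    endpoints : List (Fin n)
    endpoints = concatMap ends nonEdges

    length-endpoints : length endpoints ≡ 2 ℕ.* nonEdgeCount G
    length-endpoints = trans (length-concatMap _ nonEdges) (trans (sum-two nonEdges) (cong (2 ℕ.*_) length-nonEdges))
      where
      sum-two : ∀ {A : Set} (xs : List A) → sum (map (λ _ → 2) xs) ≡ 2 ℕ.* length xs
      sum-two []       = refl
      sum-two (x ∷ xs) = trans (cong (2 ℕ.+_) (sum-two xs)) (sym (ℕ.*-suc 2 (length xs)))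

    nonFull⊆endpoints : ∀ {u} → u ∈ filter (¬? ∘ full?) (allFin n) → u ∈ endpoints
    nonFull⊆endpoints {u} u∈ with Fin.¬∀⟶∃¬ n _ (λ w → (u Fin.≟ w) ⊎-dec (adj G u w Bool.≟ true))
                                               (proj₂ (∈-filter⁻ (¬? ∘ full?) {xs = allFin n} u∈))
    ... | w , ¬uw = endpoint (ℕ.<-cmp (toℕ u) (toℕ w))
      where
      u≢w : u ≢ w
      u≢w = ¬uw ∘ inj₁
      ¬adj : adj G u w ≡ false
      ¬adj = Bool.¬-not (¬uw ∘ inj₂)
      via : ∀ {e} → e ∈ nonEdges → u ∈ (proj₁ e ∷ proj₂ e ∷ []) → u ∈ endpoints
      via e∈ u∈e = ∈-concatMap⁺ ends (Any.map (λ { refl → u∈e }) e∈)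
      endpoint : Tri (toℕ u ℕ.< toℕ w) (toℕ u ≡ toℕ w) (toℕ w ℕ.< toℕ u) → u ∈ endpoints
      endpoint (tri< u<w _ _) = via (∈-nonEdges u<w ¬adj) (here refl)
      endpoint (tri≈ _ u≡w _) = ⊥-elim (u≢w (Fin.toℕ-injective u≡w))
      endpoint (tri> _ _ w<u) = via (∈-nonEdges w<u (trans (Graph.sym G w u) ¬adj)) (there (here refl))

    n≤full+2nonEdges : n ℕ.≤ length fullVertices ℕ.+ 2 ℕ.* nonEdgeCount G
    n≤full+2nonEdges = begin
      n                                                   ≡⟨ sym (length-tabulate (λ i → i)) ⟩
      length (allFin n)                                   ≡⟨ sym (length-filter-partition full? (allFin n)) ⟩
      length fullVertices ℕ.+ length (filter (¬? ∘ full?) (allFin n))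
        ≤⟨ ℕ.+-monoʳ-≤ (length fullVertices) (length-≤-injection _≡_ endpoints (Unique.filter⁺ (¬? ∘ full?) {allFin n} (Unique.allFin⁺ n))
                                              (λ {u} u∈ → u , nonFull⊆endpoints u∈ , refl) (λ { refl refl → refl })) ⟩
      length fullVertices ℕ.+ length endpoints            ≡⟨ cong (length fullVertices ℕ.+_) length-endpoints ⟩
      length fullVertices ℕ.+ 2 ℕ.* nonEdgeCount G         ∎
      where open ℕ.≤-Reasoning

    fullVertices-sorted : AllPairs (λ u v → toℕ u ℕ.< toℕ v) fullVertices
    fullVertices-sorted = AllPairs.filter⁺ full? {allFin n} (AllPairs.tabulate⁺-< (λ i<j → i<j))

    full⇒adj : ∀ {u w} → u ∈ fullVertices → u ≢ w → adj G u w ≡ true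
    full⇒adj {u} {w} u∈ u≢w with proj₂ (∈-filter⁻ full? {xs = allFin n} u∈) w
    ... | inj₁ u≡w = ⊥-elim (u≢w u≡w)
    ... | inj₂ uw  = uw

  module _ {n : ℕ} (G : Graph n) (k : ℕ) (lab : SuperEdgeMagicLabeling (addIsolated G k)) where

    open SuperEdgeMagicLabeling lab

    H : Graph (n ℕ.+ k)
    H = addIsolated G k

    M : ℕ
    M = n ℕ.+ k

    E : ℕ
    E = edgeCount H

    edge : (u v : Fin n) → toℕ u ℕ.< toℕ v → adj G u v ≡ true → Edge H
    edge u v u<v uv = u ↑ˡ k , v ↑ˡ k , subst₂ ℕ._<_ (sym (Fin.toℕ-↑ˡ u k)) (sym (Fin.toℕ-↑ˡ v k)) u<v , trans (adj-↑ˡ G k u v) uv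

    edge-≡ : ∀ (e e′ : Edge H) → proj₁ e ≡ proj₁ e′ → proj₁ (proj₂ e) ≡ proj₁ (proj₂ e′) → e ≡ e′
    edge-≡ (x , y , x<y , xy) (.x , .y , x<y′ , xy′) refl refl =
      cong₂ (λ p q → x , y , p , q) (Fin.<-irrelevant x<y x<y′) (Decidable⇒UIP.≡-irrelevant Bool._≟_ xy xy′)

    vertexLabel : Fin n → ℕ
    vertexLabel u = f (inj₁ (u ↑ˡ k))

    private
      labelOf : ∀ u v → Dec (toℕ u ℕ.< toℕ v) → (b : Bool) → adj G u v ≡ b → ℕ
      labelOf u v (yes u<v) true uv = f (inj₂ (edge u v u<v uv))
      labelOf u v _         _    _  = 0

    -- 0 is a junk value on pairs that are not edges of G
    edgeLabel : Fin n × Fin n → ℕ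
    edgeLabel (u , v) = labelOf u v (toℕ u ℕ.<? toℕ v) (adj G u v) refl

    edge-endpoints : ∀ {u v} (e : Edge H) → proj₁ e ≡ u ↑ˡ k → proj₁ (proj₂ e) ≡ v ↑ˡ k → toℕ u ℕ.< toℕ v × adj G u v ≡ true
    edge-endpoints {u} {v} (x , y , x<y , xy) refl refl =
      subst₂ ℕ._<_ (Fin.toℕ-↑ˡ u k) (Fin.toℕ-↑ˡ v k) x<y , trans (sym (adj-↑ˡ G k u v)) xy

    edgeLabel-≡ : ∀ {u v} (e : Edge H) → proj₁ e ≡ u ↑ˡ k → proj₁ (proj₂ e) ≡ v ↑ˡ k → edgeLabel (u , v) ≡ f (inj₂ e)
    edgeLabel-≡ {u} {v} e e₁ e₂ = label (toℕ u ℕ.<? toℕ v) (adj G u v) refl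
      where
      label : ∀ d b (uv : adj G u v ≡ b) → labelOf u v d b uv ≡ f (inj₂ e)
      label (yes u<v) true  uv = cong (λ e′ → f (inj₂ e′)) (edge-≡ _ e (sym e₁) (sym e₂))
      label (yes _)   false uv with () ← trans (sym uv) (proj₂ (edge-endpoints e e₁ e₂))
      label (no u≮v)  _     uv = ⊥-elim (u≮v (proj₁ (edge-endpoints e e₁ e₂)))

    M<edgeLabel : ∀ e → M ℕ.< f (inj₂ e)
    M<edgeLabel e with f (inj₂ e) ℕ.≤? M
    ... | no  fe≰M = ℕ.≰⇒> fe≰M
    ... | yes fe≤M with vOnto (f (inj₂ e)) (proj₁ (range (inj₂ e))) fe≤M
    ...   | v , fv≡fe with inj fv≡fe
    ...     | ()

    edgeLabel∈interval : ∀ e → f (inj₂ e) ∈ interval (suc M) E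
    edgeLabel∈interval e = ∈-interval⁺ (suc M) E (M<edgeLabel e) (ℕ.s≤s (proj₂ (range (inj₂ e))))

    -- Every label above M belongs to an edge, and edges of H are pairs u < v of vertices of G.
    2E+n≤n² : 2 ℕ.* E ℕ.+ n ℕ.≤ n ℕ.* n
    2E+n≤n² = begin
      2 ℕ.* E ℕ.+ n                                 ≤⟨ ℕ.+-monoˡ-≤ n (ℕ.*-monoʳ-≤ 2 E≤pairs) ⟩
      2 ℕ.* length (pairs (allFin n)) ℕ.+ n          ≡⟨ subst (λ l → 2 ℕ.* length (pairs (allFin n)) ℕ.+ l ≡ l ℕ.* l)
                                                              (length-tabulate (λ i → i)) (length-pairs (allFin n)) ⟩
      n ℕ.* n                                       ∎
      where
      open ℕ.≤-Reasoning
      Labels : ℕ → Fin n × Fin n → Set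
      Labels x (u , v) = Σ[ e ∈ Edge H ] f (inj₂ e) ≡ x × proj₁ e ≡ u ↑ˡ k × proj₁ (proj₂ e) ≡ v ↑ˡ k
      sorted : AllPairs (λ u v → toℕ u ℕ.< toℕ v) (allFin n)
      sorted = AllPairs.tabulate⁺-< (λ i<j → i<j)
      labelled : ∀ {x} → x ∈ interval (suc M) E → Σ[ p ∈ Fin n × Fin n ] p ∈ pairs (allFin n) × Labels x p
      labelled {x} x∈ with ∈-interval⁻ (suc M) E x∈
      ... | M<x , _ with onto x (ℕ.≤-trans (ℕ.s≤s ℕ.z≤n) M<x) (ℕ.≤-pred (proj₂ (∈-interval⁻ (suc M) E x∈)))
      ...   | inj₁ v , fv≡x = ⊥-elim (ℕ.<-irrefl refl (ℕ.≤-trans M<x (ℕ.≤-trans (ℕ.≤-reflexive (sym fv≡x)) (vRange v))))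
      ...   | inj₂ e@(x′ , y′ , _ , x′y′) , fe≡x with adj-addIsolated⁻ G k x′ y′ x′y′
      ...     | u , v , refl , refl =
        (u , v) , ∈-pairs⁺ (λ {c} → ℕ.<-irrefl refl) ℕ.<-asym sorted (∈-allFin u) (∈-allFin v) (proj₁ (edge-endpoints e refl refl)) ,
        e , fe≡x , refl , refl
      labels-injective : ∀ {x x′ p} → Labels x p → Labels x′ p → x ≡ x′
      labels-injective (e , fe≡x , e₁ , e₂) (e′ , fe′≡x′ , e₁′ , e₂′) =
        trans (sym fe≡x) (trans (cong (λ d → f (inj₂ d)) (edge-≡ e e′ (trans e₁ (sym e₁′)) (trans e₂ (sym e₂′)))) fe′≡x′)
      E≤pairs : E ℕ.≤ length (pairs (allFin n))
      E≤pairs = subst (ℕ._≤ length (pairs (allFin n))) (length-interval (suc M) E)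
                  (length-≤-injection Labels (pairs (allFin n)) (interval⁺ (suc M) E) labelled labels-injective)

    private
      clique : List (Fin n)
      clique = fullVertices G

      cliqueEdge : ∀ {u v} → (u , v) ∈ pairs clique → Edge H
      cliqueEdge {u} {v} uv∈ = edge u v u<v (full⇒adj G (proj₁ (∈-pairs⁻ clique uv∈)) (λ u≡v → ℕ.<-irrefl (cong toℕ u≡v) u<v))
        where u<v = ∈-pairs⇒R (fullVertices-sorted G) uv∈

      edgeLabel-clique : ∀ {u v} (uv∈ : (u , v) ∈ pairs clique) → edgeLabel (u , v) ≡ f (inj₂ (cliqueEdge uv∈))
      edgeLabel-clique uv∈ = edgeLabel-≡ (cliqueEdge uv∈) refl refl

    clique-magic : ∀ {u v} → (u , v) ∈ pairs clique → vertexLabel u ℕ.+ vertexLabel v ℕ.+ edgeLabel (u , v) ≡ c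
    clique-magic {u} {v} uv∈ = trans (cong (vertexLabel u ℕ.+ vertexLabel v ℕ.+_) (edgeLabel-clique uv∈)) (magic (cliqueEdge uv∈))

    clique-labels-unique : Unique (map edgeLabel (pairs clique))
    clique-labels-unique = map⁺-injectiveOn edgeLabel injectiveOn (pairs⁺ (Unique.filter⁺ (full? G) {allFin n} (Unique.allFin⁺ n)))
      where
      injectiveOn : ∀ {p q} → p ∈ pairs clique → q ∈ pairs clique → edgeLabel p ≡ edgeLabel q → p ≡ q
      injectiveOn {u , v} {u′ , v′} p∈ q∈ ℓp≡ℓq =
        cong₂ _,_ (Fin.↑ˡ-injective k u u′ (cong proj₁ e≡e′)) (Fin.↑ˡ-injective k v v′ (cong (proj₁ ∘ proj₂) e≡e′))
        where e≡e′ = inj₂-injective (inj (trans (sym (edgeLabel-clique p∈)) (trans ℓp≡ℓq (edgeLabel-clique q∈))))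

    clique-labels-in : ∀ {p} → p ∈ pairs clique → edgeLabel p ∈ interval (suc M) E
    clique-labels-in {u , v} p∈ = subst (_∈ interval (suc M) E) (sym (edgeLabel-clique p∈)) (edgeLabel∈interval (cliqueEdge p∈))

open import Defs
open import Data.Nat using (ℕ; _*_; _<_; _≤_)
open import Data.Product using (∃; _×_)
open import Data.Nat using (suc; _+_)
open import Data.Nat.Properties using (≤-trans; m≤n*m; <⇒≤; +-cancelʳ-<; <-≤-trans; *-distribʳ-+)
open import Data.List using (length)
open import Data.Product using (_,_)
open import Relation.Binary.PropositionalEquality using (subst)
open Estimates using (edge-budget)
open MagicClique using (no-magic-clique)
open FullClique

mainTheorem4 : ∀ (α : ℕ) → 1 ≤ α →
    ∃ λ (j : ℕ) → 1 ≤ j ×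
    (∀ (n : ℕ) → j < n → 2 * α < n →
    ∀ (G : Graph n) → InKnMinus α G → DeficiencyInfinite G)
mainTheorem4 α 1≤α = 20002 * α , ≤-trans 1≤α (m≤n*m α 20002) , deficiency-infinite
  where
  -- the hypothesis 2α < n is implied by 20002α < n
  deficiency-infinite : ∀ n → 20002 * α < n → 2 * α < n → ∀ (G : Graph n) → InKnMinus α G → DeficiencyInfinite G
  deficiency-infinite n 20002α<n _ G α-missing k lab =
    no-magic-clique (fullVertices G) (vertexLabel G k lab) (edgeLabel G k lab) (SuperEdgeMagicLabeling.c lab)
                    (clique-magic G k lab) (suc (M G k lab)) (E G k lab) (clique-labels-unique G k lab) (clique-labels-in G k lab)
                    1≤α 20000α≤t (edge-budget {E G k lab} {n} {t} {α} (2E+n≤n² G k lab) n≤t+2α α≤t)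
    where
    t = length (fullVertices G)
    n≤t+2α : n ≤ t + 2 * α
    n≤t+2α = subst (λ β → n ≤ t + 2 * β) α-missing (n≤full+2nonEdges G)
    20000α≤t : 20000 * α ≤ t
    20000α≤t = <⇒≤ (+-cancelʳ-< (2 * α) (20000 * α) t (<-≤-trans (subst (_< n) (*-distribʳ-+ α 20000 2) 20002α<n) n≤t+2α))
    α≤t : α ≤ t
    α≤t = ≤-trans (m≤n*m α 20000) 20000α≤t
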